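{- Let $1\le k\le n$. Let $\mathrm{OGr}(k,n)\subset \mathrm{Gr}(k,n)\subset \mathbb{P}(\wedge^k\mathbb{C}^n)$ be the variety of $k$-dimensional subspaces $V\subseteq\mathbb{C}^n$ that are isotropic for the standard symmetric bilinear form $(x,y)=x_1y_1+\dots+x_ny_n$ (i.e. $(x,y)=0$ for all $x,y\in V$). Then, in addition to the Plücker relations, $\mathrm{OGr}(k,n)$ is cut out set-theoretically in $\mathbb{P}(\wedge^k\mathbb{C}^n)$ by the following $\frac12\binom{n}{k-1}\left(\binom{n}{k-1}+1\right)$ quadratic equations, one for each unordered pair $\{I,J\}$ (with $I=J$ allowed) of $(k-1)$-element subsets of $[n]$, each written as an increasing string: $$\sum_{\ell=1}^{n}\varepsilon(I\ell)\,\varepsilon(J\ell)\,p_{I\ell}\,p_{J\ell}=0 .$$ That is, a point of $\mathbb{P}(\wedge^k\mathbb{C}^n)$ lies in $\mathrm{OGr}(k,n)$ if and only if it satisfies the Plücker relations and all of these equations.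
   Context: Plücker coordinates on $\mathbb{P}(\wedge^k\mathbb{C}^n)$ are denoted $p_I$ for $k$-subsets $I\subseteq[n]$. For a $(k-1)$-subset $I=\{i_1<\dots<i_{k-1}\}$ and $\ell\in[n]$, $I\ell$ denotes the string $i_1\cdots i_{k-1}\ell$; $p_{I\ell}$ denotes the Plücker coordinate indexed by the underlying set $I\cup\{\ell\}$ (and is $0$ if $\ell\in I$), and $\varepsilon(I\ell)$ is the sign of the permutation that sorts the string $I\ell$ into increasing order. -}

module Defs where

open import Level using (Level; _⊔_; suc)
open import Algebra.Bundles using (CommutativeRing)
open import Data.Nat as ℕ using (ℕ; zero; pred) renaming (suc to sucℕ)
open import Data.Fin using (Fin; toℕ)
open import Data.Fin.Subset using (Subset; _∪_; ⁅_⁆; ∣_∣; inside; outside) renaming (_-_ to _∖_)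
open import Data.Fin.Subset.Properties using (_∈?_)
open import Data.Vec using (_∷_; [])
open import Data.List using (List; []; _∷_; _++_; map; foldr; allFin)
open import Data.Product using (Σ; ∃; _×_; _,_)
open import Relation.Nullary using (¬_; yes; no)
open import Relation.Binary.PropositionalEquality using (_≡_)

record Field (c ℓ : Level) : Set (Level.suc (c ⊔ ℓ)) where
  field
    commutativeRing : CommutativeRing c ℓ
  open CommutativeRing commutativeRing public
  field
    0≉1     : ¬ (0# ≈ 1#)
    inverse : ∀ x → ¬ (x ≈ 0#) → ∃ λ y → x * y ≈ 1#

module FieldNotions {c ℓ : Level} (F : Field c ℓ) where
  open Field F

  natCast : ℕ → Carrier
  natCast zero     = 0#
  natCast (sucℕ m) = 1# + natCast m

  CharZero : Set ℓ
  CharZero = ∀ m → ¬ (natCast (sucℕ m) ≈ 0#)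

  -- value at x of the monic polynomial x^m + c₁ x^(m-1) + ... + c_m,
  -- given the list [c₁, ..., c_m]  (Horner scheme)
  evalMonic : List Carrier → Carrier → Carrier
  evalMonic cs x = go 1# cs
    where
    go : Carrier → List Carrier → Carrier
    go acc []       = acc
    go acc (d ∷ ds) = go (acc * x + d) ds

  AlgClosed : Set (c ⊔ ℓ)
  AlgClosed = ∀ (d : Carrier) (ds : List Carrier) → ∃ λ x → evalMonic (d ∷ ds) x ≈ 0#

  sumL : List Carrier → Carrier
  sumL = foldr _+_ 0#

  Σ[_] : ∀ {m} → (Fin m → Carrier) → Carrier
  Σ[ f ] = sumL (map f (allFin _))

  sgn : ℕ → Carrier
  sgn zero     = 1#
  sgn (sucℕ m) = - sgn m

  picks : ∀ {a} {A : Set a} → List A → List (A × List A)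
  picks []       = []
  picks (x ∷ xs) = (x , xs) ∷ map (λ { (y , ys) → (y , x ∷ ys) }) (picks xs)

  -- det of the square matrix with the given rows, restricted to the given
  -- (ordered) list of columns; meaningful when both lists have equal length
  det : ∀ {n} → List (Fin n → Carrier) → List (Fin n) → Carrier
  det []       _    = 1#
  det (r ∷ rs) cols = alt 0 (picks cols)
    where
    alt : ℕ → List (Fin _ × List (Fin _)) → Carrier
    alt i []                = 0#
    alt i ((j , rest) ∷ ps) = sgn i * (r j * det rs rest) + alt (sucℕ i) ps

  elems : ∀ {n} → Subset n → List (Fin n)
  elems []              = []
  elems (inside  ∷ s)   = Fin.zero ∷ map Fin.suc (elems s)
  elems (outside ∷ s)   = map Fin.suc (elems s)

  inversions : ∀ {n} → List (Fin n) → ℕ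
  inversions []       = 0
  inversions (x ∷ xs) = count xs ℕ.+ inversions xs
    where
    count : List (Fin _) → ℕ
    count []       = 0
    count (y ∷ ys) with toℕ y ℕ.<? toℕ x
    ... | yes _ = sucℕ (count ys)
    ... | no  _ = count ys

  ε : ∀ {n} → List (Fin n) → Carrier
  ε s = sgn (inversions s)

  -- vectors of ∧^k F^n: coordinate functions p on subsets of [n];
  -- only the values p I with ∣ I ∣ ≡ k are ever used (p_I).

  pAdd : ∀ {n} → (Subset n → Carrier) → Subset n → Fin n → Carrier
  pAdd p I ℓ with ℓ ∈? I
  ... | yes _ = 0#
  ... | no  _ = p (I ∪ ⁅ ℓ ⁆)

  Nonzero : (k n : ℕ) → (Subset n → Carrier) → Set ℓ
  Nonzero k n p = ∃ λ (I : Subset n) → (∣ I ∣ ≡ k) × ¬ (p I ≈ 0#)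

  sp : ∀ {n} → (Subset n → Carrier) → Subset n → Fin n → Carrier
  sp p I ℓ = ε (elems I ++ (ℓ ∷ [])) * pAdd p I ℓ

  pluckerPoly : ∀ {n} → (Subset n → Carrier) → Subset n → Subset n → Carrier
  pluckerPoly {n} p I J = alt 0 (elems J)
    where
    alt : ℕ → List (Fin n) → Carrier
    alt i []       = 0#
    alt i (j ∷ js) = sgn i * (sp p I j * p (J ∖ j)) + alt (sucℕ i) js

  PluckerRelations : (k n : ℕ) → (Subset n → Carrier) → Set ℓ
  PluckerRelations k n p =
    ∀ (I J : Subset n) → ∣ I ∣ ≡ pred k → ∣ J ∣ ≡ sucℕ k →
      pluckerPoly p I J ≈ 0#

  -- the quadrics of the theorem:  Σ_ℓ ε(Iℓ) ε(Jℓ) p_{Iℓ} p_{Jℓ}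
  -- (stated for all ordered pairs (I , J); this is the same set of equations
  --  as the one indexed by unordered pairs {I , J}, the polynomial being symmetric)
  orthoQuadric : ∀ {n} → (Subset n → Carrier) → Subset n → Subset n → Carrier
  orthoQuadric p I J = Σ[ (λ ℓ → sp p I ℓ * sp p J ℓ) ]

  OrthoQuadrics : (k n : ℕ) → (Subset n → Carrier) → Set ℓ
  OrthoQuadrics k n p =
    ∀ (I J : Subset n) → ∣ I ∣ ≡ pred k → ∣ J ∣ ≡ pred k →
      orthoQuadric p I J ≈ 0#

  form : ∀ {n} → (Fin n → Carrier) → (Fin n → Carrier) → Carrier
  form x y = Σ[ (λ i → x i * y i) ]

  lincomb : ∀ {k n} → (Fin k → Fin n → Carrier) → (Fin k → Carrier) → Fin n → Carrier
  lincomb A γ j = Σ[ (λ r → γ r * A r j) ]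

  minor : ∀ {k n} → (Fin k → Fin n → Carrier) → Subset n → Carrier
  minor {k} A I = det (map A (allFin k)) (elems I)

  -- p (a nonzero vector of ∧^k F^n) represents a point of OGr(k,n):
  -- p is, up to a nonzero scalar, v_1 ∧ ... ∧ v_k for vectors v_1,...,v_k
  -- (the rows of A; they are independent since p ≠ 0) whose span V is isotropic,
  -- i.e. (x , y) = 0 for all x , y ∈ V.
  InOGr : (k n : ℕ) → (Subset n → Carrier) → Set (c ⊔ ℓ)
  InOGr k n p =
    Σ (Fin k → Fin n → Carrier) λ A → Σ Carrier λ λ₀ →
      ¬ (λ₀ ≈ 0#) ×
      (∀ I → ∣ I ∣ ≡ k → p I ≈ λ₀ * minor A I) ×
      (∀ (γ δ : Fin k → Carrier) → form (lincomb A γ) (lincomb A δ) ≈ 0#)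

{-# OPTIONS --safe #-}
-- Extend p to the alternating function P(s) = ε(s) p_{set of s} of strings s of length k
-- (zero when a letter repeats). For a (k-1)-set I the vector ℓ ↦ ε(Iℓ) p_{Iℓ} is ℓ ↦ P(I ℓ);
-- the Plücker relation for (I, J) is the Laplace expansion of P at J along this vector, and
-- the quadric for (I, J) is the scalar product of the vectors of I and J.
-- If p = λ · (maximal minors of A), then P = λ · det A on all strings, being alternating and
-- equal to it on increasing ones; so every vector ℓ ↦ P(I ℓ) lies in the row space of A, each
-- Plücker relation is λ² times a determinant with a repeated row, and the quadrics vanish
-- because the row space is isotropic.
-- Conversely, let p_{I₀} ≠ 0. By alternation the Plücker relations hold for all strings J, not
-- only increasing ones, and expanding one row at a time they show that the matrix with rows
-- ℓ ↦ P((I₀ ∖ y) ℓ), y ∈ I₀, has maximal minors proportional to p. These rows are pairwise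
-- orthogonal by the quadrics, so they span an isotropic subspace.
module Submission where

open import Defs

open import Algebra.Bundles using (Ring)
import Algebra.Properties.CommutativeSemigroup as CommutativeSemigroupProperties
open import Data.Fin as Fin using (Fin; toℕ)
import Data.Fin.Properties as Finₚ
open import Data.Fin.Subset as Sub using (Subset; inside; outside; _∪_; ⁅_⁆; ∣_∣) renaming (_-_ to _∖_; _∈_ to _∈ˢ_)
import Data.Fin.Subset.Properties as Subₚ
open import Data.List as List using (List; []; _∷_; _++_; map; length; allFin; tabulate)
import Data.List.Properties as Listₚ
open import Data.List.Membership.Propositional using (_∈_)
import Data.List.Membership.Propositional.Properties as Any
import Data.List.Relation.Unary.All as All
import Data.List.Relation.Unary.All.Properties as Allₚ
open import Data.List.Relation.Unary.AllPairs using ([]; _∷_)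
open import Data.List.Relation.Unary.Any using (here; there)
open import Data.List.Relation.Unary.Unique.Propositional using (Unique)
import Data.List.Relation.Unary.Unique.Propositional.Properties as Uniqueₚ
open import Data.Nat as ℕ using (ℕ; zero; suc; _≤_; _<_; _<?_; s≤s; z≤n)
import Data.Nat.Properties as ℕₚ
open import Data.Product using (Σ; ∃; _×_; _,_; proj₁; proj₂)
open import Data.Vec.Base using (_∷_; [])
import Data.Vec.Base as Vec using (here; there)
import Data.Vec.Functional as Vector
open import Function using (_∘_; id)
open import Function.Bundles using (_⇔_; mk⇔)
open import Level using (_⊔_)
open import Relation.Binary.Definitions using (tri<; tri≈; tri>)
open import Relation.Binary.PropositionalEquality as ≡ using (_≡_; _≢_)
open import Relation.Nullary using (yes; no; ¬_; contradiction)

module ℕ+ = CommutativeSemigroupProperties ℕₚ.+-commutativeSemigroup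

module _ {a} {A : Set a} where

  length-++-∷≢0 : ∀ (s : List A) x t → length (s ++ x ∷ t) ≢ 0
  length-++-∷≢0 [] x t ()
  length-++-∷≢0 (_ ∷ s) x t ()

  length-swap : ∀ (s : List A) x y t → length (s ++ y ∷ x ∷ t) ≡ length (s ++ x ∷ y ∷ t)
  length-swap [] x y t = ≡.refl
  length-swap (_ ∷ s) x y t = ≡.cong suc (length-swap s x y t)

  length-++-∷-suc : ∀ (u : List A) y {v s} → length s ≡ suc (length v) → length (u ++ y ∷ s) ≡ suc (length (u ++ y ∷ v))
  length-++-∷-suc [] y e = ≡.cong suc e
  length-++-∷-suc (_ ∷ u) y e = ≡.cong suc (length-++-∷-suc u y e)

  Unique-++-∷⇒≢ : ∀ (u : List A) {y v x} → Unique (u ++ y ∷ v) → x ∈ u → x ≢ y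
  Unique-++-∷⇒≢ (x ∷ u) (x∉ ∷ _) (here ≡.refl) = All.lookup x∉ (Any.∈-++⁺ʳ u (here ≡.refl))
  Unique-++-∷⇒≢ (_ ∷ u) (_ ∷ unique) (there x∈u) = Unique-++-∷⇒≢ u unique x∈u

  tabulation : ∀ {m} (xs : List A) → length xs ≡ m → Σ (Fin m → A) λ g → map g (allFin m) ≡ xs
  tabulation xs ≡.refl = List.lookup xs , ≡.trans (Listₚ.map-tabulate id (List.lookup xs)) (Listₚ.tabulate-lookup xs)

[_<_] : ∀ {n} → Fin n → Fin n → ℕ
[ y < x ] with toℕ y <? toℕ x
... | yes _ = 1
... | no _ = 0

below : ∀ {n} → Fin n → List (Fin n) → ℕ
below x [] = 0
below x (y ∷ ys) = [ y < x ] ℕ.+ below x ys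

[<]≡1 : ∀ {n} {x y : Fin n} → toℕ y < toℕ x → [ y < x ] ≡ 1
[<]≡1 {x = x} {y} y<x with toℕ y <? toℕ x
... | yes _ = ≡.refl
... | no y≮x = contradiction y<x y≮x

[<]≡0 : ∀ {n} {x y : Fin n} → ¬ toℕ y < toℕ x → [ y < x ] ≡ 0
[<]≡0 {x = x} {y} y≮x with toℕ y <? toℕ x
... | yes y<x = contradiction y<x y≮x
... | no _ = ≡.refl

[suc<suc] : ∀ {n} (x y : Fin n) → [ Fin.suc y < Fin.suc x ] ≡ [ y < x ]
[suc<suc] x y with toℕ y <? toℕ x
... | yes y<x = [<]≡1 (s≤s y<x)
... | no y≮x = [<]≡0 (λ sy<sx → y≮x (ℕₚ.≤-pred sy<sx))

below-swap : ∀ {n} (x : Fin n) s a b t → below x (s ++ a ∷ b ∷ t) ≡ below x (s ++ b ∷ a ∷ t)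
below-swap x [] a b t = ℕ+.x∙yz≈y∙xz [ a < x ] [ b < x ] (below x t)
below-swap x (y ∷ s) a b t = ≡.cong ([ y < x ] ℕ.+_) (below-swap x s a b t)

below-zero : ∀ {n} (l : List (Fin (suc n))) → below Fin.zero l ≡ 0
below-zero [] = ≡.refl
below-zero (y ∷ l) = ≡.cong₂ ℕ._+_ ([<]≡0 {x = Fin.zero} {y} λ ()) (below-zero l)

below-map-suc : ∀ {n} (x : Fin n) l → below (Fin.suc x) (map Fin.suc l) ≡ below x l
below-map-suc x [] = ≡.refl
below-map-suc x (y ∷ l) = ≡.cong₂ ℕ._+_ ([suc<suc] x y) (below-map-suc x l)

module Strings {c ℓ} (F : Field c ℓ) where
  open FieldNotions F using (inversions; elems; picks)
  open ≡.≡-Reasoning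

  -- Defs.inversions counts through a function local to its where-block, which cannot be
  -- named directly; the with-abstraction below makes it the solution of the metavariable `counter`.
  mutual
    counter : ∀ {n} → Fin n → List (Fin n) → List (Fin n) → ℕ
    counter = _

    inversions-counter : ∀ {n} (x y : Fin n) ys → toℕ y < toℕ x →
                         inversions (x ∷ y ∷ ys) ≡ suc (counter x (y ∷ ys) ys ℕ.+ inversions (y ∷ ys))
    inversions-counter x y ys y<x with toℕ y <? toℕ x
    ... | yes _ with y ∷ ys | inversions (y ∷ ys)
    ...   | L | K = ≡.refl
    inversions-counter x y ys y<x | no y≮x = contradiction y<x y≮x

  counter≡below : ∀ {n} (x : Fin n) L ys → counter x L ys ≡ below x ys
  counter≡below x L [] = ≡.refl
  counter≡below x L (y ∷ ys) with toℕ y <? toℕ x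
  ... | yes _ = ≡.cong suc (counter≡below x L ys)
  ... | no _ = counter≡below x L ys

  inversions-∷ : ∀ {n} (x : Fin n) ys → inversions (x ∷ ys) ≡ below x ys ℕ.+ inversions ys
  inversions-∷ x ys = ≡.cong (ℕ._+ inversions ys) (counter≡below x ys ys)

  inversions-swap : ∀ {n} (s : List (Fin n)) a b t → toℕ a < toℕ b →
                    inversions (s ++ b ∷ a ∷ t) ≡ suc (inversions (s ++ a ∷ b ∷ t))
  inversions-swap [] a b t a<b = begin
    inversions (b ∷ a ∷ t)
      ≡⟨ inversions-∷ b (a ∷ t) ⟩
    [ a < b ] ℕ.+ below b t ℕ.+ inversions (a ∷ t)
      ≡⟨ ≡.cong₂ ℕ._+_ (≡.cong (ℕ._+ below b t) ([<]≡1 a<b)) (inversions-∷ a t) ⟩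
    suc (below b t ℕ.+ (below a t ℕ.+ inversions t))
      ≡⟨ ≡.cong suc (ℕ+.x∙yz≈y∙xz (below b t) (below a t) (inversions t)) ⟩
    suc (below a t ℕ.+ (below b t ℕ.+ inversions t))
      ≡⟨ ≡.cong₂ (λ i j → suc (i ℕ.+ below a t ℕ.+ j)) ([<]≡0 (ℕₚ.<⇒≯ a<b)) (inversions-∷ b t) ⟨
    suc ([ b < a ] ℕ.+ below a t ℕ.+ inversions (b ∷ t))
      ≡⟨ ≡.cong suc (inversions-∷ a (b ∷ t)) ⟨
    suc (inversions (a ∷ b ∷ t))
      ∎
  inversions-swap (x ∷ s) a b t a<b = begin
    inversions (x ∷ s ++ b ∷ a ∷ t)
      ≡⟨ inversions-∷ x (s ++ b ∷ a ∷ t) ⟩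
    below x (s ++ b ∷ a ∷ t) ℕ.+ inversions (s ++ b ∷ a ∷ t)
      ≡⟨ ≡.cong₂ ℕ._+_ (below-swap x s b a t) (inversions-swap s a b t a<b) ⟩
    below x (s ++ a ∷ b ∷ t) ℕ.+ suc (inversions (s ++ a ∷ b ∷ t))
      ≡⟨ ℕₚ.+-suc _ _ ⟩
    suc (below x (s ++ a ∷ b ∷ t) ℕ.+ inversions (s ++ a ∷ b ∷ t))
      ≡⟨ ≡.cong suc (inversions-∷ x (s ++ a ∷ b ∷ t)) ⟨
    suc (inversions (x ∷ s ++ a ∷ b ∷ t))
      ∎

  inversions-map-suc : ∀ {n} (l : List (Fin n)) → inversions (map Fin.suc l) ≡ inversions l
  inversions-map-suc [] = ≡.refl
  inversions-map-suc (x ∷ l) = begin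
    inversions (Fin.suc x ∷ map Fin.suc l)                           ≡⟨ inversions-∷ (Fin.suc x) (map Fin.suc l) ⟩
    below (Fin.suc x) (map Fin.suc l) ℕ.+ inversions (map Fin.suc l) ≡⟨ ≡.cong₂ ℕ._+_ (below-map-suc x l) (inversions-map-suc l) ⟩
    below x l ℕ.+ inversions l                                       ≡⟨ inversions-∷ x l ⟨
    inversions (x ∷ l)                                               ∎

  inversions-elems : ∀ {n} (X : Subset n) → inversions (elems X) ≡ 0
  inversions-elems [] = ≡.refl
  inversions-elems (inside ∷ X) = begin
    inversions (Fin.zero ∷ map Fin.suc (elems X))
      ≡⟨ inversions-∷ Fin.zero (map Fin.suc (elems X)) ⟩
    below Fin.zero (map Fin.suc (elems X)) ℕ.+ inversions (map Fin.suc (elems X))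
      ≡⟨ ≡.cong₂ ℕ._+_ (below-zero (map Fin.suc (elems X))) (≡.trans (inversions-map-suc (elems X)) (inversions-elems X)) ⟩
    0 ∎
  inversions-elems (outside ∷ X) = ≡.trans (inversions-map-suc (elems X)) (inversions-elems X)

  elems-⊥ : ∀ {n} → elems (Sub.⊥ {n}) ≡ []
  elems-⊥ {zero} = ≡.refl
  elems-⊥ {suc n} = ≡.cong (map Fin.suc) (elems-⊥ {n})

  setOf : ∀ {n} → List (Fin n) → Subset n
  setOf [] = Sub.⊥
  setOf (x ∷ xs) = ⁅ x ⁆ ∪ setOf xs

  setOf-swap : ∀ {n} (s : List (Fin n)) a b t → setOf (s ++ a ∷ b ∷ t) ≡ setOf (s ++ b ∷ a ∷ t)
  setOf-swap [] a b t = begin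
    ⁅ a ⁆ ∪ (⁅ b ⁆ ∪ setOf t)  ≡⟨ Subₚ.∪-assoc ⁅ a ⁆ ⁅ b ⁆ (setOf t) ⟨
    (⁅ a ⁆ ∪ ⁅ b ⁆) ∪ setOf t  ≡⟨ ≡.cong (_∪ setOf t) (Subₚ.∪-comm ⁅ a ⁆ ⁅ b ⁆) ⟩
    (⁅ b ⁆ ∪ ⁅ a ⁆) ∪ setOf t  ≡⟨ Subₚ.∪-assoc ⁅ b ⁆ ⁅ a ⁆ (setOf t) ⟩
    ⁅ b ⁆ ∪ (⁅ a ⁆ ∪ setOf t)  ∎
  setOf-swap (x ∷ s) a b t = ≡.cong (⁅ x ⁆ ∪_) (setOf-swap s a b t)

  setOf-repeat : ∀ {n} (s : List (Fin n)) a t → setOf (s ++ a ∷ a ∷ t) ≡ setOf (s ++ a ∷ t)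
  setOf-repeat [] a t = ≡.trans (≡.sym (Subₚ.∪-assoc ⁅ a ⁆ ⁅ a ⁆ (setOf t))) (≡.cong (_∪ setOf t) (Subₚ.∪-idem ⁅ a ⁆))
  setOf-repeat (x ∷ s) a t = ≡.cong (⁅ x ⁆ ∪_) (setOf-repeat s a t)

  setOf-map-suc : ∀ {n} (l : List (Fin n)) → setOf (map Fin.suc l) ≡ outside ∷ setOf l
  setOf-map-suc [] = ≡.refl
  setOf-map-suc (x ∷ l) = ≡.cong (⁅ Fin.suc x ⁆ ∪_) (setOf-map-suc l)

  setOf-elems : ∀ {n} (X : Subset n) → setOf (elems X) ≡ X
  setOf-elems [] = ≡.refl
  setOf-elems (inside ∷ X) rewrite setOf-map-suc (elems X) | setOf-elems X = ≡.cong (inside ∷_) (Subₚ.∪-identityˡ X)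
  setOf-elems (outside ∷ X) rewrite setOf-map-suc (elems X) | setOf-elems X = ≡.refl

  setOf-∷ʳ : ∀ {n} (l : List (Fin n)) j → setOf (l ++ j ∷ []) ≡ setOf l ∪ ⁅ j ⁆
  setOf-∷ʳ [] j = ≡.trans (Subₚ.∪-identityʳ ⁅ j ⁆) (≡.sym (Subₚ.∪-identityˡ ⁅ j ⁆))
  setOf-∷ʳ (x ∷ l) j = ≡.trans (≡.cong (⁅ x ⁆ ∪_) (setOf-∷ʳ l j)) (≡.sym (Subₚ.∪-assoc ⁅ x ⁆ (setOf l) ⁅ j ⁆))

  ∣⁅x⁆∪p∣≤1+∣p∣ : ∀ {n} (x : Fin n) (p : Subset n) → ∣ ⁅ x ⁆ ∪ p ∣ ≤ suc ∣ p ∣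
  ∣⁅x⁆∪p∣≤1+∣p∣ Fin.zero (s ∷ p) rewrite Subₚ.∪-identityˡ p = s≤s (Subₚ.∣p∣≤∣x∷p∣ s p)
  ∣⁅x⁆∪p∣≤1+∣p∣ (Fin.suc x) (inside ∷ p) = s≤s (∣⁅x⁆∪p∣≤1+∣p∣ x p)
  ∣⁅x⁆∪p∣≤1+∣p∣ (Fin.suc x) (outside ∷ p) = ∣⁅x⁆∪p∣≤1+∣p∣ x p

  ∣setOf∣≤length : ∀ {n} (l : List (Fin n)) → ∣ setOf l ∣ ≤ length l
  ∣setOf∣≤length {n} [] = ℕₚ.≤-reflexive (Subₚ.∣⊥∣≡0 n)
  ∣setOf∣≤length (x ∷ l) = ℕₚ.≤-trans (∣⁅x⁆∪p∣≤1+∣p∣ x (setOf l)) (s≤s (∣setOf∣≤length l))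

  length-elems : ∀ {n} (X : Subset n) → length (elems X) ≡ ∣ X ∣
  length-elems [] = ≡.refl
  length-elems (inside ∷ X) = ≡.cong suc (≡.trans (Listₚ.length-map Fin.suc (elems X)) (length-elems X))
  length-elems (outside ∷ X) = ≡.trans (Listₚ.length-map Fin.suc (elems X)) (length-elems X)

  x∈p⇒p∪⁅x⁆≡p : ∀ {n} {x : Fin n} {p : Subset n} → x ∈ˢ p → p ∪ ⁅ x ⁆ ≡ p
  x∈p⇒p∪⁅x⁆≡p {p = inside ∷ p} Vec.here = ≡.cong (inside ∷_) (Subₚ.∪-identityʳ p)
  x∈p⇒p∪⁅x⁆≡p {p = inside ∷ p} (Vec.there x∈p) = ≡.cong (inside ∷_) (x∈p⇒p∪⁅x⁆≡p x∈p)
  x∈p⇒p∪⁅x⁆≡p {p = outside ∷ p} (Vec.there x∈p) = ≡.cong (outside ∷_) (x∈p⇒p∪⁅x⁆≡p x∈p)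

  x∉p⇒∣p∪⁅x⁆∣≡1+∣p∣ : ∀ {n} (x : Fin n) (p : Subset n) → ¬ x ∈ˢ p → ∣ p ∪ ⁅ x ⁆ ∣ ≡ suc ∣ p ∣
  x∉p⇒∣p∪⁅x⁆∣≡1+∣p∣ Fin.zero (inside ∷ p) x∉p = contradiction Vec.here x∉p
  x∉p⇒∣p∪⁅x⁆∣≡1+∣p∣ Fin.zero (outside ∷ p) x∉p = ≡.cong suc (≡.cong ∣_∣ (Subₚ.∪-identityʳ p))
  x∉p⇒∣p∪⁅x⁆∣≡1+∣p∣ (Fin.suc x) (inside ∷ p) x∉p = ≡.cong suc (x∉p⇒∣p∪⁅x⁆∣≡1+∣p∣ x p (x∉p ∘ Vec.there))
  x∉p⇒∣p∪⁅x⁆∣≡1+∣p∣ (Fin.suc x) (outside ∷ p) x∉p = x∉p⇒∣p∪⁅x⁆∣≡1+∣p∣ x p (x∉p ∘ Vec.there)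

  x∈p⇒1+∣p-x∣≡∣p∣ : ∀ {n} {x : Fin n} {p : Subset n} → x ∈ˢ p → suc ∣ p ∖ x ∣ ≡ ∣ p ∣
  x∈p⇒1+∣p-x∣≡∣p∣ {p = inside ∷ p} Vec.here = ≡.cong suc (≡.cong ∣_∣ (Subₚ.p─⊥≡p p))
  x∈p⇒1+∣p-x∣≡∣p∣ {p = inside ∷ p} (Vec.there x∈p) = ≡.cong suc (x∈p⇒1+∣p-x∣≡∣p∣ x∈p)
  x∈p⇒1+∣p-x∣≡∣p∣ {p = outside ∷ p} (Vec.there x∈p) = x∈p⇒1+∣p-x∣≡∣p∣ x∈p

  x∈p⇒[p-x]∪⁅x⁆≡p : ∀ {n} {x : Fin n} {p : Subset n} → x ∈ˢ p → (p ∖ x) ∪ ⁅ x ⁆ ≡ p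
  x∈p⇒[p-x]∪⁅x⁆≡p {p = inside ∷ p} Vec.here = ≡.cong (inside ∷_) (≡.trans (Subₚ.∪-identityʳ _) (Subₚ.p─⊥≡p p))
  x∈p⇒[p-x]∪⁅x⁆≡p {p = inside ∷ p} (Vec.there x∈p) = ≡.cong (inside ∷_) (x∈p⇒[p-x]∪⁅x⁆≡p x∈p)
  x∈p⇒[p-x]∪⁅x⁆≡p {p = outside ∷ p} (Vec.there x∈p) = ≡.cong (outside ∷_) (x∈p⇒[p-x]∪⁅x⁆≡p x∈p)

  x∉p-x : ∀ {n} (x : Fin n) (p : Subset n) → ¬ x ∈ˢ p ∖ x
  x∉p-x Fin.zero (s ∷ p) ()
  x∉p-x (Fin.suc x) (s ∷ p) (Vec.there x∈p-x) = x∉p-x x p x∈p-x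

  ∈elems⇒∈ : ∀ {n} {x : Fin n} (X : Subset n) → x ∈ elems X → x ∈ˢ X
  ∈elems⇒∈ (inside ∷ X) (here ≡.refl) = Vec.here
  ∈elems⇒∈ (inside ∷ X) (there x∈) with Any.∈-map⁻ Fin.suc x∈
  ... | y , y∈ , ≡.refl = Vec.there (∈elems⇒∈ X y∈)
  ∈elems⇒∈ (outside ∷ X) x∈ with Any.∈-map⁻ Fin.suc x∈
  ... | y , y∈ , ≡.refl = Vec.there (∈elems⇒∈ X y∈)

  elems-unique : ∀ {n} (X : Subset n) → Unique (elems X)
  elems-unique [] = []
  elems-unique (inside ∷ X) =
    Allₚ.map⁺ (All.universal (λ _ ()) (elems X)) ∷ Uniqueₚ.map⁺ Finₚ.suc-injective (elems-unique X)
  elems-unique (outside ∷ X) = Uniqueₚ.map⁺ Finₚ.suc-injective (elems-unique X)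

  picks-map : ∀ {n m} (g : Fin n → Fin m) l →
              picks (map g l) ≡ map (λ q → g (proj₁ q) , map g (proj₂ q)) (picks l)
  picks-map g [] = ≡.refl
  picks-map g (x ∷ xs) = ≡.cong ((g x , map g xs) ∷_)
    (≡.trans (≡.cong (map _) (picks-map g xs)) (≡.trans (≡.sym (Listₚ.map-∘ (picks xs))) (Listₚ.map-∘ (picks xs))))

  picks-elems : ∀ {n} (J : Subset n) → picks (elems J) ≡ map (λ j → j , elems (J ∖ j)) (elems J)
  picks-elems [] = ≡.refl
  picks-elems (inside ∷ J) = ≡.cong₂ _∷_
    (≡.cong (λ K → Fin.zero , map Fin.suc (elems K)) (≡.sym (Subₚ.p─⊥≡p J)))
    (begin
      map _ (picks (map Fin.suc (elems J)))  ≡⟨ ≡.cong (map _) (picks-map Fin.suc (elems J)) ⟩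
      map _ (map _ (picks (elems J)))        ≡⟨ ≡.cong (λ ps → map _ (map _ ps)) (picks-elems J) ⟩
      map _ (map _ (map _ (elems J)))        ≡⟨ ≡.trans (≡.sym (Listₚ.map-∘ _)) (≡.sym (Listₚ.map-∘ (elems J))) ⟩
      map _ (elems J)                        ≡⟨ Listₚ.map-∘ (elems J) ⟩
      map _ (map Fin.suc (elems J))          ∎)
  picks-elems (outside ∷ J) = ≡.trans (picks-map Fin.suc (elems J))
    (≡.trans (≡.cong (map _) (picks-elems J)) (≡.trans (≡.sym (Listₚ.map-∘ (elems J))) (Listₚ.map-∘ (elems J))))

  setOf-elems-∷ʳ : ∀ {n} (I : Subset n) j → setOf (elems I ++ j ∷ []) ≡ I ∪ ⁅ j ⁆
  setOf-elems-∷ʳ I j = ≡.trans (setOf-∷ʳ (elems I) j) (≡.cong (_∪ ⁅ j ⁆) (setOf-elems I))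

  length-elems-∷ʳ : ∀ {n} (I : Subset n) j → length (elems I ++ j ∷ []) ≡ suc (length (elems I))
  length-elems-∷ʳ I j = ≡.trans (Listₚ.length-++-sucʳ (elems I) j []) (≡.cong (suc ∘ length) (Listₚ.++-identityʳ (elems I)))

  ∣setOf∣<length-repeat : ∀ {n} (s : List (Fin n)) a t → ∣ setOf (s ++ a ∷ a ∷ t) ∣ < length (s ++ a ∷ a ∷ t)
  ∣setOf∣<length-repeat s a t rewrite setOf-repeat s a t | Listₚ.length-++-sucʳ s a (a ∷ t) =
    s≤s (∣setOf∣≤length (s ++ a ∷ t))

  ∈⇒∣setOf[elems∷ʳ]∣≢length : ∀ {n} {I : Subset n} {j} → j ∈ˢ I →
                              ∣ setOf (elems I ++ j ∷ []) ∣ ≢ length (elems I ++ j ∷ [])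
  ∈⇒∣setOf[elems∷ʳ]∣≢length {I = I} {j} j∈I
    rewrite setOf-elems-∷ʳ I j | x∈p⇒p∪⁅x⁆≡p j∈I | length-elems-∷ʳ I j | length-elems I = ℕₚ.1+n≢n ∘ ≡.sym

  ∉⇒∣setOf[elems∷ʳ]∣≡length : ∀ {n} {I : Subset n} {j} → ¬ j ∈ˢ I →
                              ∣ setOf (elems I ++ j ∷ []) ∣ ≡ length (elems I ++ j ∷ [])
  ∉⇒∣setOf[elems∷ʳ]∣≡length {I = I} {j} j∉I
    rewrite setOf-elems-∷ʳ I j | x∉p⇒∣p∪⁅x⁆∣≡1+∣p∣ j I j∉I | length-elems-∷ʳ I j | length-elems I = ≡.refl

module RingIdentities {r₁ r₂} (R : Ring r₁ r₂) where
  open Ring R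
  open import Algebra.Properties.Ring R using (-‿distribʳ-*; -0#≈0#; -‿involutive; -‿+-comm; ⁻¹-anti-homo‿-)
  open import Algebra.Properties.CommutativeSemigroup +-commutativeSemigroup using (interchange)
  open import Relation.Binary.Reasoning.Setoid setoid

  x-0≈x : ∀ x → x - 0# ≈ x
  x-0≈x x = trans (+-congˡ -0#≈0#) (+-identityʳ x)

  -‿cong₂ : ∀ {a b x y} → a ≈ b → x ≈ y → a - x ≈ b - y
  -‿cong₂ a≈b x≈y = +-cong a≈b (-‿cong x≈y)

  -‿congˡ : ∀ {a x y} → x ≈ y → a - x ≈ a - y
  -‿congˡ = -‿cong₂ refl

  [u+v]-[w+z]≈[u-w]+[v-z] : ∀ u v w z → (u + v) - (w + z) ≈ (u - w) + (v - z)
  [u+v]-[w+z]≈[u-w]+[v-z] u v w z = begin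
    (u + v) + - (w + z)   ≈⟨ +-congˡ (sym (-‿+-comm w z)) ⟩
    (u + v) + (- w + - z) ≈⟨ interchange u v (- w) (- z) ⟩
    (u - w) + (v - z)     ∎

  u-[v-w]≈[u-v]+w : ∀ u v w → u - (v - w) ≈ (u - v) + w
  u-[v-w]≈[u-v]+w u v w = begin
    u + - (v + - w)   ≈⟨ +-congˡ (sym (-‿+-comm v (- w))) ⟩
    u + (- v + - - w) ≈⟨ +-congˡ (+-congˡ (-‿involutive w)) ⟩
    u + (- v + w)     ≈⟨ sym (+-assoc u (- v) w) ⟩
    (u - v) + w       ∎

  [u-v]-w≈[u-w]-v : ∀ u v w → (u - v) - w ≈ (u - w) - v
  [u-v]-w≈[u-w]-v u v w = begin
    (u + - v) + - w ≈⟨ +-assoc u (- v) (- w) ⟩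
    u + (- v + - w) ≈⟨ +-congˡ (+-comm (- v) (- w)) ⟩
    u + (- w + - v) ≈⟨ sym (+-assoc u (- w) (- v)) ⟩
    (u + - w) + - v ∎

  u-[v-w]≈-[v-[u-z]] : ∀ u v w z → w ≈ - z → u - (v - w) ≈ - (v - (u - z))
  u-[v-w]≈-[v-[u-z]] u v w z w≈-z = begin
    u - (v - w)     ≈⟨ u-[v-w]≈[u-v]+w u v w ⟩
    (u - v) + w     ≈⟨ +-congˡ w≈-z ⟩
    (u - v) - z     ≈⟨ [u-v]-w≈[u-w]-v u v z ⟩
    (u - z) - v     ≈⟨ ⁻¹-anti-homo‿- v (u - z) ⟨
    - (v - (u - z)) ∎

  x*[-y]-[-z]≈-[x*y-z] : ∀ x y z → x * (- y) - (- z) ≈ - (x * y - z)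
  x*[-y]-[-z]≈-[x*y-z] x y z = trans (-‿cong₂ (sym (-‿distribʳ-* x y)) refl) (-‿+-comm (x * y) (- z))

module _ {c ℓ} (F : Field c ℓ) where
  open Field F
  open FieldNotions F
  open Strings F
  open RingIdentities ring
  open import Algebra.Properties.Ring ring
    using (-‿distribˡ-*; -‿distribʳ-*; x[y-z]≈xy-xz; [y-z]x≈yx-zx; -0#≈0#; -‿involutive; -‿+-comm; x∙y⁻¹≈ε⇒x≈y; -1*x≈-x)
  open import Algebra.Properties.CommutativeSemigroup *-commutativeSemigroup
    using (x∙yz≈y∙xz) renaming (interchange to interchange*)
  open import Algebra.Properties.Semiring.Sum semiring
    using (sum; sum-cong-≋; ∑-distrib-+; sum-replicate-zero; ∑-comm; *-distribˡ-sum; *-distribʳ-sum)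
  open import Relation.Binary.Reasoning.Setoid setoid

  x*y≉0 : ∀ {x y} → ¬ (x ≈ 0#) → ¬ (y ≈ 0#) → ¬ (x * y ≈ 0#)
  x*y≉0 {x} {y} x≉0 y≉0 xy≈0 with inverse x x≉0
  ... | x⁻¹ , xx⁻¹≈1 = y≉0 (begin
    y              ≈⟨ sym (*-identityˡ y) ⟩
    1# * y         ≈⟨ *-congʳ (sym (trans (*-comm x⁻¹ x) xx⁻¹≈1)) ⟩
    (x⁻¹ * x) * y  ≈⟨ *-assoc x⁻¹ x y ⟩
    x⁻¹ * (x * y)  ≈⟨ *-congˡ xy≈0 ⟩
    x⁻¹ * 0#       ≈⟨ zeroʳ x⁻¹ ⟩
    0#             ∎)

  sgn*sgn≈1 : ∀ m → sgn m * sgn m ≈ 1#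
  sgn*sgn≈1 zero = *-identityˡ 1#
  sgn*sgn≈1 (suc m) = begin
    - sgn m * - sgn m   ≈⟨ sym (-‿distribˡ-* (sgn m) (- sgn m)) ⟩
    - (sgn m * - sgn m) ≈⟨ -‿cong (sym (-‿distribʳ-* (sgn m) (sgn m))) ⟩
    - - (sgn m * sgn m) ≈⟨ -‿involutive _ ⟩
    sgn m * sgn m       ≈⟨ sgn*sgn≈1 m ⟩
    1#                  ∎

  sgn≉0 : ∀ m → ¬ (sgn m ≈ 0#)
  sgn≉0 m sgn≈0 = 0≉1 (begin
    0#            ≈⟨ sym (zeroʳ (sgn m)) ⟩
    sgn m * 0#    ≈⟨ *-congˡ (sym sgn≈0) ⟩
    sgn m * sgn m ≈⟨ sgn*sgn≈1 m ⟩
    1#            ∎)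

  sgn*x≈0⇒x≈0 : ∀ m {x} → sgn m * x ≈ 0# → x ≈ 0#
  sgn*x≈0⇒x≈0 m {x} sgn*x≈0 = begin
    x                    ≈⟨ sym (*-identityˡ x) ⟩
    1# * x               ≈⟨ *-congʳ (sym (sgn*sgn≈1 m)) ⟩
    (sgn m * sgn m) * x  ≈⟨ *-assoc _ _ _ ⟩
    sgn m * (sgn m * x)  ≈⟨ *-congˡ sgn*x≈0 ⟩
    sgn m * 0#           ≈⟨ zeroʳ _ ⟩
    0#                   ∎

  Σ≡sum : ∀ {m} (f : Fin m → Carrier) → Σ[ f ] ≡ sum f
  Σ≡sum f = ≡.trans (≡.cong sumL (Listₚ.map-tabulate id f)) (sumL-tabulate f)
    where
    sumL-tabulate : ∀ {m} (g : Fin m → Carrier) → sumL (tabulate g) ≡ sum g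
    sumL-tabulate {zero} g = ≡.refl
    sumL-tabulate {suc m} g = ≡.cong (g Fin.zero +_) (sumL-tabulate (g ∘ Fin.suc))

  lincomb≡sum : ∀ {k n} (A : Fin k → Fin n → Carrier) γ x → lincomb A γ x ≡ sum (λ r → γ r * A r x)
  lincomb≡sum A γ x = Σ≡sum (λ r → γ r * A r x)

  form≡sum : ∀ {n} (x y : Fin n → Carrier) → form x y ≡ sum (λ i → x i * y i)
  form≡sum x y = Σ≡sum (λ i → x i * y i)

  sum-neg : ∀ {m} (f : Fin m → Carrier) → sum (λ i → - f i) ≈ - sum f
  sum-neg f = begin
    sum (λ i → - f i)       ≈⟨ sum-cong-≋ (λ i → sym (-1*x≈-x (f i))) ⟩
    sum (λ i → - 1# * f i)  ≈⟨ sym (*-distribˡ-sum (- 1#) f) ⟩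
    - 1# * sum f            ≈⟨ -1*x≈-x (sum f) ⟩
    - sum f                 ∎

  sum-vanishes : ∀ {m} (f : Fin m → Carrier) → (∀ i → f i ≈ 0#) → sum f ≈ 0#
  sum-vanishes {m} f f≈0 = trans (sum-cong-≋ f≈0) (sum-replicate-zero m)

  form-comm : ∀ {n} (x y : Fin n → Carrier) → form x y ≈ form y x
  form-comm x y = begin
    form x y                   ≡⟨ form≡sum x y ⟩
    sum (λ i → x i * y i)      ≈⟨ sum-cong-≋ (λ i → *-comm (x i) (y i)) ⟩
    sum (λ i → y i * x i)      ≡⟨ form≡sum y x ⟨
    form y x                   ∎

  form-lincombˡ : ∀ {k n} (A : Fin k → Fin n → Carrier) γ y →
                  form (lincomb A γ) y ≈ sum (λ r → γ r * form (A r) y)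
  form-lincombˡ A γ y = begin
    form (lincomb A γ) y
      ≡⟨ form≡sum _ y ⟩
    sum (λ i → lincomb A γ i * y i)
      ≈⟨ sum-cong-≋ (λ i → trans (*-congʳ (reflexive (lincomb≡sum A γ i))) (*-distribʳ-sum (y i) (λ r → γ r * A r i))) ⟩
    sum (λ i → sum (λ r → (γ r * A r i) * y i))
      ≈⟨ ∑-comm (λ i r → (γ r * A r i) * y i) ⟩
    sum (λ r → sum (λ i → (γ r * A r i) * y i))
      ≈⟨ sum-cong-≋ (λ r → sum-cong-≋ (λ i → *-assoc (γ r) (A r i) (y i))) ⟩
    sum (λ r → sum (λ i → γ r * (A r i * y i)))
      ≈⟨ sum-cong-≋ (λ r → sym (trans (*-congˡ (reflexive (form≡sum (A r) y))) (*-distribˡ-sum (γ r) (λ i → A r i * y i)))) ⟩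
    sum (λ r → γ r * form (A r) y)
      ∎

  form-vanishes-on-span : ∀ {k n} (A : Fin k → Fin n → Carrier) →
                          (∀ r s → form (A r) (A s) ≈ 0#) →
                          ∀ γ δ → form (lincomb A γ) (lincomb A δ) ≈ 0#
  form-vanishes-on-span A rows⊥ γ δ =
    trans (form-lincombˡ A γ (lincomb A δ)) (sum-vanishes _ λ r → trans (*-congˡ (row⊥span r)) (zeroʳ (γ r)))
    where
    row⊥span : ∀ r → form (A r) (lincomb A δ) ≈ 0#
    row⊥span r = trans (form-comm (A r) (lincomb A δ)) (trans (form-lincombˡ A δ (A r))
      (sum-vanishes _ λ s → trans (*-congˡ (trans (form-comm (A s) (A r)) (rows⊥ r s))) (zeroʳ (δ s))))

  InRowSpan : ∀ {k n} → (Fin k → Fin n → Carrier) → (Fin n → Carrier) → Set (c ⊔ ℓ)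
  InRowSpan A v = ∃ λ γ → ∀ x → v x ≈ lincomb A γ x

  lincomb-∷ : ∀ {k n} (A : Fin (suc k) → Fin n → Carrier) a γ x →
              lincomb A (a Vector.∷ γ) x ≈ a * A Fin.zero x + lincomb (A ∘ Fin.suc) γ x
  lincomb-∷ A a γ x = reflexive (≡.trans (lincomb≡sum A _ x) (≡.cong (a * A Fin.zero x +_) (≡.sym (lincomb≡sum (A ∘ Fin.suc) γ x))))

  inRowSpan-head : ∀ {k n} (A : Fin (suc k) → Fin n → Carrier) a → InRowSpan A (λ x → a * A Fin.zero x)
  inRowSpan-head A a = a Vector.∷ (λ _ → 0#) , λ x → sym (begin
    lincomb A (a Vector.∷ (λ _ → 0#)) x             ≈⟨ lincomb-∷ A a _ x ⟩
    a * A Fin.zero x + lincomb (A ∘ Fin.suc) _ x     ≈⟨ +-congˡ (trans (reflexive (lincomb≡sum (A ∘ Fin.suc) _ x)) (sum-vanishes (λ r → 0# * A (Fin.suc r) x) λ r → zeroˡ _)) ⟩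
    a * A Fin.zero x + 0#                            ≈⟨ +-identityʳ _ ⟩
    a * A Fin.zero x                                 ∎)

  inRowSpan-tail : ∀ {k n} (A : Fin (suc k) → Fin n → Carrier) {v} → InRowSpan (A ∘ Fin.suc) v → InRowSpan A v
  inRowSpan-tail A (γ , v≈γA) = 0# Vector.∷ γ , λ x → begin
    _                                                ≈⟨ v≈γA x ⟩
    lincomb (A ∘ Fin.suc) γ x                        ≈⟨ sym (+-identityˡ _) ⟩
    0# + lincomb (A ∘ Fin.suc) γ x                   ≈⟨ +-congʳ (sym (zeroˡ _)) ⟩
    0# * A Fin.zero x + lincomb (A ∘ Fin.suc) γ x    ≈⟨ sym (lincomb-∷ A 0# γ x) ⟩
    lincomb A (0# Vector.∷ γ) x                      ∎

  inRowSpan-linear : ∀ {k n} (A : Fin k → Fin n → Carrier) a {u v} → InRowSpan A u → InRowSpan A v →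
                     InRowSpan A (λ x → a * u x - v x)
  inRowSpan-linear A a {u} {v} (γ , u≈γA) (δ , v≈δA) = (λ r → a * γ r - δ r) , λ x → begin
    a * u x - v x
      ≈⟨ -‿cong₂ (*-congˡ (trans (u≈γA x) (reflexive (lincomb≡sum A γ x)))) (trans (v≈δA x) (reflexive (lincomb≡sum A δ x))) ⟩
    a * sum (λ r → γ r * A r x) - sum (λ r → δ r * A r x)
      ≈⟨ +-cong (*-distribˡ-sum a (λ r → γ r * A r x)) (sym (sum-neg (λ r → δ r * A r x))) ⟩
    sum (λ r → a * (γ r * A r x)) + sum (λ r → - (δ r * A r x))
      ≈⟨ sym (∑-distrib-+ (λ r → a * (γ r * A r x)) (λ r → - (δ r * A r x))) ⟩
    sum (λ r → a * (γ r * A r x) - δ r * A r x)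
      ≈⟨ sum-cong-≋ (λ r → sym (trans ([y-z]x≈yx-zx (A r x) (a * γ r) (δ r)) (+-congʳ (*-assoc a (γ r) (A r x))))) ⟩
    sum (λ r → (a * γ r - δ r) * A r x)
      ≡⟨ lincomb≡sum A _ x ⟨
    lincomb A (λ r → a * γ r - δ r) x
      ∎

  -- expand r f s = Σᵢ (-1)ⁱ r(sᵢ) f(s without sᵢ)
  expand : ∀ {n} → (Fin n → Carrier) → (List (Fin n) → Carrier) → List (Fin n) → Carrier
  expand r f [] = 0#
  expand r f (x ∷ xs) = r x * f xs - expand r (λ l → f (x ∷ l)) xs

  expand-cong : ∀ {n} (r : Fin n → Carrier) {f g} cs →
                (∀ l → suc (length l) ≡ length cs → f l ≈ g l) → expand r f cs ≈ expand r g cs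
  expand-cong r [] f≈g = refl
  expand-cong r (x ∷ cs) f≈g =
    -‿cong₂ (*-congˡ (f≈g cs ≡.refl)) (expand-cong r cs (λ l e → f≈g (x ∷ l) (≡.cong suc e)))

  expand-congʳ : ∀ {n} {r s : Fin n → Carrier} f cs → (∀ x → r x ≈ s x) → expand r f cs ≈ expand s f cs
  expand-congʳ f [] r≈s = refl
  expand-congʳ f (x ∷ cs) r≈s = -‿cong₂ (*-congʳ (r≈s x)) (expand-congʳ (λ l → f (x ∷ l)) cs r≈s)

  expand-zero : ∀ {n} (r : Fin n → Carrier) cs → expand r (λ _ → 0#) cs ≈ 0#
  expand-zero r [] = refl
  expand-zero r (x ∷ cs) = begin
    r x * 0# - expand r (λ _ → 0#) cs ≈⟨ -‿cong₂ (zeroʳ (r x)) (expand-zero r cs) ⟩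
    0# - 0#                          ≈⟨ -‿inverseʳ 0# ⟩
    0#                               ∎

  expand-vanishes : ∀ {n} (r : Fin n → Carrier) f cs →
                    (∀ l → suc (length l) ≡ length cs → f l ≈ 0#) → expand r f cs ≈ 0#
  expand-vanishes r f cs f≈0 = trans (expand-cong r cs f≈0) (expand-zero r cs)

  expand-scale : ∀ {n} (r : Fin n → Carrier) a f cs → expand r (λ l → a * f l) cs ≈ a * expand r f cs
  expand-scale r a f [] = sym (zeroʳ a)
  expand-scale r a f (x ∷ cs) = begin
    r x * (a * f cs) - expand r (λ l → a * f (x ∷ l)) cs
      ≈⟨ -‿cong₂ (x∙yz≈y∙xz (r x) a (f cs)) (expand-scale r a (λ l → f (x ∷ l)) cs) ⟩
    a * (r x * f cs) - a * expand r (λ l → f (x ∷ l)) cs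
      ≈⟨ sym (x[y-z]≈xy-xz a _ _) ⟩
    a * (r x * f cs - expand r (λ l → f (x ∷ l)) cs)
      ∎

  expand-+ : ∀ {n} (r : Fin n → Carrier) f g cs →
             expand r (λ l → f l + g l) cs ≈ expand r f cs + expand r g cs
  expand-+ r f g [] = sym (+-identityʳ 0#)
  expand-+ r f g (x ∷ cs) = begin
    r x * (f cs + g cs) - expand r (λ l → f (x ∷ l) + g (x ∷ l)) cs
      ≈⟨ -‿cong₂ (distribˡ (r x) (f cs) (g cs)) (expand-+ r (λ l → f (x ∷ l)) (λ l → g (x ∷ l)) cs) ⟩
    (r x * f cs + r x * g cs) - (expand r (λ l → f (x ∷ l)) cs + expand r (λ l → g (x ∷ l)) cs)
      ≈⟨ [u+v]-[w+z]≈[u-w]+[v-z] _ _ _ _ ⟩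
    (r x * f cs - expand r (λ l → f (x ∷ l)) cs) + (r x * g cs - expand r (λ l → g (x ∷ l)) cs)
      ∎

  expand-neg : ∀ {n} (r : Fin n → Carrier) f cs → expand r (λ l → - f l) cs ≈ - expand r f cs
  expand-neg r f [] = sym -0#≈0#
  expand-neg r f (x ∷ cs) = begin
    r x * (- f cs) - expand r (λ l → - f (x ∷ l)) cs
      ≈⟨ -‿cong₂ (sym (-‿distribʳ-* (r x) (f cs))) (expand-neg r (λ l → f (x ∷ l)) cs) ⟩
    - (r x * f cs) - - expand r (λ l → f (x ∷ l)) cs
      ≈⟨ -‿+-comm _ _ ⟩
    - (r x * f cs - expand r (λ l → f (x ∷ l)) cs)
      ∎

  expand-linear : ∀ {n} (r : Fin n → Carrier) a f g cs →
                  expand r (λ l → a * f l - g l) cs ≈ a * expand r f cs - expand r g cs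
  expand-linear r a f g cs = begin
    expand r (λ l → a * f l - g l) cs
      ≈⟨ expand-+ r (λ l → a * f l) (λ l → - g l) cs ⟩
    expand r (λ l → a * f l) cs + expand r (λ l → - g l) cs
      ≈⟨ +-cong (expand-scale r a f cs) (expand-neg r g cs) ⟩
    a * expand r f cs - expand r g cs
      ∎

  expand-++ : ∀ {n} (r : Fin n → Carrier) f u w → (∀ x → x ∈ u → r x ≈ 0#) →
              expand r f (u ++ w) ≈ sgn (length u) * expand r (λ l → f (u ++ l)) w
  expand-++ r f [] w _ = sym (*-identityˡ _)
  expand-++ r f (x ∷ u) w r≈0 = begin
    r x * f (u ++ w) - expand r (λ l → f (x ∷ l)) (u ++ w)
      ≈⟨ -‿cong₂ (trans (*-congʳ (r≈0 x (here ≡.refl))) (zeroˡ _)) (expand-++ r (λ l → f (x ∷ l)) u w (λ y y∈u → r≈0 y (there y∈u))) ⟩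
    0# - sgn (length u) * expand r (λ l → f (x ∷ u ++ l)) w
      ≈⟨ +-identityˡ _ ⟩
    - (sgn (length u) * expand r (λ l → f (x ∷ u ++ l)) w)
      ≈⟨ -‿distribˡ-* _ _ ⟩
    - sgn (length u) * expand r (λ l → f (x ∷ u ++ l)) w
      ∎

  expand-row-zero : ∀ {n} f (cs : List (Fin n)) → expand (λ _ → 0#) f cs ≈ 0#
  expand-row-zero f [] = refl
  expand-row-zero f (x ∷ cs) = begin
    0# * f cs - expand (λ _ → 0#) (λ l → f (x ∷ l)) cs ≈⟨ -‿cong₂ (zeroˡ (f cs)) (expand-row-zero (λ l → f (x ∷ l)) cs) ⟩
    0# - 0#                                            ≈⟨ -‿inverseʳ 0# ⟩
    0#                                                 ∎

  expand-row-scale : ∀ {n} (r : Fin n → Carrier) a f cs → expand (λ x → a * r x) f cs ≈ a * expand r f cs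
  expand-row-scale r a f [] = sym (zeroʳ a)
  expand-row-scale r a f (x ∷ cs) = begin
    (a * r x) * f cs - expand (λ x → a * r x) (λ l → f (x ∷ l)) cs
      ≈⟨ -‿cong₂ (*-assoc a (r x) (f cs)) (expand-row-scale r a (λ l → f (x ∷ l)) cs) ⟩
    a * (r x * f cs) - a * expand r (λ l → f (x ∷ l)) cs
      ≈⟨ sym (x[y-z]≈xy-xz a _ _) ⟩
    a * (r x * f cs - expand r (λ l → f (x ∷ l)) cs)
      ∎

  expand-row-+ : ∀ {n} (r s : Fin n → Carrier) f cs → expand (λ x → r x + s x) f cs ≈ expand r f cs + expand s f cs
  expand-row-+ r s f [] = sym (+-identityʳ 0#)
  expand-row-+ r s f (x ∷ cs) = begin
    (r x + s x) * f cs - expand (λ x → r x + s x) (λ l → f (x ∷ l)) cs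
      ≈⟨ -‿cong₂ (distribʳ (f cs) (r x) (s x)) (expand-row-+ r s (λ l → f (x ∷ l)) cs) ⟩
    (r x * f cs + s x * f cs) - (expand r (λ l → f (x ∷ l)) cs + expand s (λ l → f (x ∷ l)) cs)
      ≈⟨ [u+v]-[w+z]≈[u-w]+[v-z] _ _ _ _ ⟩
    (r x * f cs - expand r (λ l → f (x ∷ l)) cs) + (s x * f cs - expand s (λ l → f (x ∷ l)) cs)
      ∎

  expand-row-lincomb : ∀ {k n} (A : Fin k → Fin n → Carrier) γ f cs →
                       expand (lincomb A γ) f cs ≈ sum (λ t → γ t * expand (A t) f cs)
  expand-row-lincomb {k} A γ f cs = begin
    expand (lincomb A γ) f cs                      ≈⟨ expand-congʳ f cs (λ x → reflexive (lincomb≡sum A γ x)) ⟩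
    expand (λ x → sum (λ t → γ t * A t x)) f cs    ≈⟨ expand-row-sum (λ t x → γ t * A t x) ⟩
    sum (λ t → expand (λ x → γ t * A t x) f cs)    ≈⟨ sum-cong-≋ (λ t → expand-row-scale (A t) (γ t) f cs) ⟩
    sum (λ t → γ t * expand (A t) f cs)            ∎
    where
    expand-row-sum : ∀ {m} (h : Fin m → Fin _ → Carrier) →
                     expand (λ x → sum (λ t → h t x)) f cs ≈ sum (λ t → expand (h t) f cs)
    expand-row-sum {zero} h = expand-row-zero f cs
    expand-row-sum {suc m} h = trans (expand-row-+ (h Fin.zero) _ f cs) (+-congˡ (expand-row-sum (h ∘ Fin.suc)))

  expand-same-row : ∀ {n} (r : Fin n → Carrier) g cs → expand r (λ l → expand r g l) cs ≈ 0#
  expand-same-row r g [] = refl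
  expand-same-row r g (x ∷ cs) = begin
    r x * expand r g cs - expand r (λ l → r x * g l - expand r (λ m → g (x ∷ m)) l) cs
      ≈⟨ -‿congˡ (expand-linear r (r x) g _ cs) ⟩
    r x * expand r g cs - (r x * expand r g cs - expand r (λ l → expand r (λ m → g (x ∷ m)) l) cs)
      ≈⟨ -‿congˡ (-‿congˡ (expand-same-row r (λ m → g (x ∷ m)) cs)) ⟩
    r x * expand r g cs - (r x * expand r g cs - 0#)
      ≈⟨ -‿congˡ (x-0≈x _) ⟩
    r x * expand r g cs - r x * expand r g cs
      ≈⟨ -‿inverseʳ _ ⟩
    0#
      ∎

  expand-anticomm : ∀ {n} (r s : Fin n → Carrier) g cs →
                    expand r (λ l → expand s g l) cs ≈ - expand s (λ l → expand r g l) cs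
  expand-anticomm r s g [] = sym -0#≈0#
  expand-anticomm r s g (x ∷ cs) = begin
    r x * expand s g cs - expand r (λ l → s x * g l - expand s (λ m → g (x ∷ m)) l) cs
      ≈⟨ -‿congˡ (expand-linear r (s x) g _ cs) ⟩
    A - (B - P)
      ≈⟨ u-[v-w]≈-[v-[u-z]] A B P Q (expand-anticomm r s (λ m → g (x ∷ m)) cs) ⟩
    - (B - (A - Q))
      ≈⟨ -‿cong (-‿congˡ (expand-linear s (r x) g _ cs)) ⟨
    - (s x * expand r g cs - expand s (λ l → r x * g l - expand r (λ m → g (x ∷ m)) l) cs)
      ∎
    where
    A = r x * expand s g cs
    B = s x * expand r g cs
    P = expand r (λ l → expand s (λ m → g (x ∷ m)) l) cs
    Q = expand s (λ l → expand r (λ m → g (x ∷ m)) l) cs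

  -- As for `counter`, this names the accumulator local to Defs.det.
  mutual
    detSum : ∀ {n} → (Fin n → Carrier) → List (Fin n → Carrier) → List (Fin n) →
             ℕ → List (Fin n × List (Fin n)) → Carrier
    detSum = _

    det-∷≡detSum : ∀ {n} (r : Fin n → Carrier) rs cols → det (r ∷ rs) cols ≡ detSum r rs cols 0 (picks cols)
    det-∷≡detSum r rs cols with 0 | picks cols
    ... | i | ps = ≡.refl

  signedSum : ∀ {n} → (Fin n → Carrier) → (List (Fin n) → Carrier) → ℕ → List (Fin n × List (Fin n)) → Carrier
  signedSum r f i [] = 0#
  signedSum r f i ((j , rest) ∷ ps) = sgn i * (r j * f rest) + signedSum r f (suc i) ps

  detSum≡signedSum : ∀ {n} (r : Fin n → Carrier) rs cols i ps → detSum r rs cols i ps ≡ signedSum r (det rs) i ps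
  detSum≡signedSum r rs cols i [] = ≡.refl
  detSum≡signedSum r rs cols i ((j , rest) ∷ ps) =
    ≡.cong (sgn i * (r j * det rs rest) +_) (detSum≡signedSum r rs cols (suc i) ps)

  signedSum-map-∷ : ∀ {n} (r : Fin n → Carrier) f x g → (∀ q → g q ≡ (proj₁ q , x ∷ proj₂ q)) →
                    ∀ i ps → signedSum r f i (map g ps) ≡ signedSum r (λ l → f (x ∷ l)) i ps
  signedSum-map-∷ r f x g g≡ i [] = ≡.refl
  signedSum-map-∷ r f x g g≡ i ((j , rest) ∷ ps) rewrite g≡ (j , rest) =
    ≡.cong (sgn i * (r j * f (x ∷ rest)) +_) (signedSum-map-∷ r f x g g≡ (suc i) ps)

  signedSum-picks : ∀ {n} (r : Fin n → Carrier) f i cols → signedSum r f i (picks cols) ≈ sgn i * expand r f cols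
  signedSum-picks r f i [] = sym (zeroʳ _)
  signedSum-picks r f i (x ∷ cs) = begin
    sgn i * (r x * f cs) + signedSum r f (suc i) (map _ (picks cs))
      ≡⟨ ≡.cong (sgn i * (r x * f cs) +_) (signedSum-map-∷ r f x _ (λ _ → ≡.refl) (suc i) (picks cs)) ⟩
    sgn i * (r x * f cs) + signedSum r (λ l → f (x ∷ l)) (suc i) (picks cs)
      ≈⟨ +-congˡ (signedSum-picks r (λ l → f (x ∷ l)) (suc i) cs) ⟩
    sgn i * (r x * f cs) + - sgn i * expand r (λ l → f (x ∷ l)) cs
      ≈⟨ +-congˡ (sym (-‿distribˡ-* _ _)) ⟩
    sgn i * (r x * f cs) - sgn i * expand r (λ l → f (x ∷ l)) cs
      ≈⟨ sym (x[y-z]≈xy-xz _ _ _) ⟩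
    sgn i * (r x * f cs - expand r (λ l → f (x ∷ l)) cs)
      ∎

  det-∷ : ∀ {n} (r : Fin n → Carrier) rs cols → det (r ∷ rs) cols ≈ expand r (det rs) cols
  det-∷ r rs cols = begin
    det (r ∷ rs) cols                          ≡⟨ det-∷≡detSum r rs cols ⟩
    detSum r rs cols 0 (picks cols)            ≡⟨ detSum≡signedSum r rs cols 0 (picks cols) ⟩
    signedSum r (det rs) 0 (picks cols)        ≈⟨ signedSum-picks r (det rs) 0 cols ⟩
    1# * expand r (det rs) cols                ≈⟨ *-identityˡ _ ⟩
    expand r (det rs) cols                     ∎

  expand-det-row : ∀ {n} (r : Fin n → Carrier) rs cs → r ∈ rs → expand r (det rs) cs ≈ 0#
  expand-det-row r (r ∷ rs) cs (here ≡.refl) =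
    trans (expand-cong r cs (λ l _ → det-∷ r rs l)) (expand-same-row r (det rs) cs)
  expand-det-row r (r′ ∷ rs) cs (there r∈rs) = begin
    expand r (det (r′ ∷ rs)) cs                 ≈⟨ expand-cong r cs (λ l _ → det-∷ r′ rs l) ⟩
    expand r (λ l → expand r′ (det rs) l) cs    ≈⟨ expand-anticomm r r′ (det rs) cs ⟩
    - expand r′ (λ l → expand r (det rs) l) cs  ≈⟨ -‿cong (expand-vanishes r′ _ cs (λ l _ → expand-det-row r rs l r∈rs)) ⟩
    - 0#                                        ≈⟨ -0#≈0# ⟩
    0#                                          ∎

  rows : ∀ {k n} → (Fin k → Fin n → Carrier) → List (Fin n → Carrier)
  rows {k} A = map A (allFin k)

  rows-suc : ∀ {k n} (A : Fin (suc k) → Fin n → Carrier) → rows A ≡ A Fin.zero ∷ rows (A ∘ Fin.suc)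
  rows-suc A = ≡.cong (A Fin.zero ∷_)
    (≡.trans (Listₚ.map-tabulate Fin.suc A) (≡.sym (Listₚ.map-tabulate id (A ∘ Fin.suc))))

  inRowSpan-expand : ∀ {k n} (A : Fin (suc k) → Fin n → Carrier) f s →
                     (∀ s′ → suc (length s′) ≡ length s → InRowSpan (A ∘ Fin.suc) (λ x → f (s′ ++ x ∷ []))) →
                     InRowSpan A (λ x → expand (A Fin.zero) f (s ++ x ∷ []))
  inRowSpan-expand A f [] _ = let γ , h = inRowSpan-head A (f []) in
    γ , λ x → trans (x-0≈x _) (trans (*-comm _ _) (h x))
  inRowSpan-expand A f (y ∷ s) inSpan =
    inRowSpan-linear A (A Fin.zero y) (inRowSpan-tail A (inSpan s ≡.refl))
      (inRowSpan-expand A (λ l → f (y ∷ l)) s (λ s′ e → inSpan (y ∷ s′) (≡.cong suc e)))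

  inRowSpan-det : ∀ {k n} (A : Fin k → Fin n → Carrier) s → suc (length s) ≡ k →
                  InRowSpan A (λ x → det (rows A) (s ++ x ∷ []))
  inRowSpan-det {suc k} A s e with inRowSpan-expand A (det (rows (A ∘ Fin.suc))) s
                                     (λ s′ e′ → inRowSpan-det (A ∘ Fin.suc) s′ (≡.trans e′ (ℕₚ.suc-injective e)))
  ... | γ , inSpan = γ , λ x → begin
    det (rows A) (s ++ x ∷ [])                              ≡⟨ ≡.cong (λ rs → det rs (s ++ x ∷ [])) (rows-suc A) ⟩
    det (A Fin.zero ∷ rows (A ∘ Fin.suc)) (s ++ x ∷ [])     ≈⟨ det-∷ (A Fin.zero) _ (s ++ x ∷ []) ⟩
    expand (A Fin.zero) (det (rows (A ∘ Fin.suc))) (s ++ x ∷ [])  ≈⟨ inSpan x ⟩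
    lincomb A γ x                                           ∎

  record Alternating {n} (m : ℕ) (f : List (Fin n) → Carrier) : Set ℓ where
    field
      swap   : ∀ s a b t → length (s ++ a ∷ b ∷ t) ≡ m → f (s ++ a ∷ b ∷ t) ≈ - f (s ++ b ∷ a ∷ t)
      repeat : ∀ s a t → length (s ++ a ∷ a ∷ t) ≡ m → f (s ++ a ∷ a ∷ t) ≈ 0#

  open Alternating

  alternating-∷ : ∀ {n m} {f : List (Fin n) → Carrier} x → Alternating (suc m) f → Alternating m (λ l → f (x ∷ l))
  alternating-∷ x alt = record
    { swap   = λ s a b t e → swap alt (x ∷ s) a b t (≡.cong suc e)
    ; repeat = λ s a t e → repeat alt (x ∷ s) a t (≡.cong suc e)
    }

  alternating-cong : ∀ {n m} {f g : List (Fin n) → Carrier} → (∀ l → length l ≡ m → f l ≈ g l) →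
                     Alternating m f → Alternating m g
  alternating-cong f≈g alt = record
    { swap   = λ s a b t e → trans (sym (f≈g _ e))
                 (trans (swap alt s a b t e) (-‿cong (f≈g _ (≡.trans (length-swap s a b t) e))))
    ; repeat = λ s a t e → trans (sym (f≈g _ e)) (repeat alt s a t e)
    }

  alternating-linear : ∀ {n m} {f g : List (Fin n) → Carrier} a →
                       Alternating m f → Alternating m g → Alternating m (λ s → f s - a * g s)
  alternating-linear a altf altg = record
    { swap   = λ s x y t e → begin
        _ - a * _       ≈⟨ -‿cong₂ (swap altf s x y t e) (*-congˡ (swap altg s x y t e)) ⟩
        - _ - a * - _   ≈⟨ -‿congˡ (sym (-‿distribʳ-* a _)) ⟩
        - _ - - (a * _) ≈⟨ -‿+-comm _ _ ⟩
        - (_ - a * _)   ∎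
    ; repeat = λ s x t e → begin
        _ - a * _       ≈⟨ -‿cong₂ (repeat altf s x t e) (trans (*-congˡ (repeat altg s x t e)) (zeroʳ a)) ⟩
        0# - 0#         ≈⟨ -‿inverseʳ 0# ⟩
        0#              ∎
    }

  expand-alternating : ∀ {n m} (r : Fin n → Carrier) {f} → Alternating m f → Alternating (suc m) (expand r f)
  expand-alternating {n} r alt = record { swap = swapE alt ; repeat = repeatE alt }
    where
    swapE : ∀ {m f} → Alternating m f → ∀ s a b t → length (s ++ a ∷ b ∷ t) ≡ suc m →
            expand r f (s ++ a ∷ b ∷ t) ≈ - expand r f (s ++ b ∷ a ∷ t)
    swapE {m} {f} alt [] a b t e = u-[v-w]≈-[v-[u-z]] _ _ _ _ (begin
      expand r (λ l → f (a ∷ b ∷ l)) t   ≈⟨ expand-cong r t (λ l e′ → swap alt [] a b l (≡.trans (≡.cong suc e′) (ℕₚ.suc-injective e))) ⟩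
      expand r (λ l → - f (b ∷ a ∷ l)) t ≈⟨ expand-neg r _ t ⟩
      - expand r (λ l → f (b ∷ a ∷ l)) t ∎)
    swapE {zero} alt (x ∷ s) a b t e = contradiction (ℕₚ.suc-injective e) (length-++-∷≢0 s a (b ∷ t))
    swapE {suc m} {f} alt (x ∷ s) a b t e = begin
      r x * f (s ++ a ∷ b ∷ t) - expand r (λ l → f (x ∷ l)) (s ++ a ∷ b ∷ t)
        ≈⟨ -‿cong₂ (*-congˡ (swap alt s a b t (ℕₚ.suc-injective e)))
                   (swapE (alternating-∷ x alt) s a b t (ℕₚ.suc-injective e)) ⟩
      r x * (- f (s ++ b ∷ a ∷ t)) - (- expand r (λ l → f (x ∷ l)) (s ++ b ∷ a ∷ t))
        ≈⟨ x*[-y]-[-z]≈-[x*y-z] _ _ _ ⟩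
      - (r x * f (s ++ b ∷ a ∷ t) - expand r (λ l → f (x ∷ l)) (s ++ b ∷ a ∷ t))
        ∎
    repeatE : ∀ {m f} → Alternating m f → ∀ s a t → length (s ++ a ∷ a ∷ t) ≡ suc m →
              expand r f (s ++ a ∷ a ∷ t) ≈ 0#
    repeatE {m} {f} alt [] a t e = begin
      r a * f (a ∷ t) - (r a * f (a ∷ t) - expand r (λ l → f (a ∷ a ∷ l)) t)
        ≈⟨ -‿congˡ (-‿congˡ (expand-vanishes r _ t λ l e′ → repeat alt [] a l (≡.trans (≡.cong suc e′) (ℕₚ.suc-injective e)))) ⟩
      r a * f (a ∷ t) - (r a * f (a ∷ t) - 0#)
        ≈⟨ -‿congˡ (x-0≈x _) ⟩
      r a * f (a ∷ t) - r a * f (a ∷ t)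
        ≈⟨ -‿inverseʳ _ ⟩
      0# ∎
    repeatE {zero} alt (x ∷ s) a t e = contradiction (ℕₚ.suc-injective e) (length-++-∷≢0 s a (a ∷ t))
    repeatE {suc m} {f} alt (x ∷ s) a t e = begin
      r x * f (s ++ a ∷ a ∷ t) - expand r (λ l → f (x ∷ l)) (s ++ a ∷ a ∷ t)
        ≈⟨ -‿cong₂ (*-congˡ (repeat alt s a t (ℕₚ.suc-injective e)))
                   (repeatE (alternating-∷ x alt) s a t (ℕₚ.suc-injective e)) ⟩
      r x * 0# - 0# ≈⟨ trans (x-0≈x _) (zeroʳ _) ⟩
      0# ∎

  det-alternating : ∀ {n} (rs : List (Fin n → Carrier)) → Alternating (length rs) (det rs)
  det-alternating [] = record
    { swap   = λ s a b t e → contradiction e (length-++-∷≢0 s a (b ∷ t))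
    ; repeat = λ s a t e → contradiction e (length-++-∷≢0 s a (a ∷ t))
    }
  det-alternating (r ∷ rs) = alternating-cong (λ l _ → sym (det-∷ r rs l)) (expand-alternating r (det-alternating rs))

  alternating-map-suc : ∀ {n m} {f : List (Fin (suc n)) → Carrier} →
                        Alternating m f → Alternating m (λ l → f (map Fin.suc l))
  alternating-map-suc {n} {m} {f} alt = record
    { swap   = λ s a b t e → begin
        f (map Fin.suc (s ++ a ∷ b ∷ t))                  ≡⟨ ≡.cong f (Listₚ.map-++ Fin.suc s (a ∷ b ∷ t)) ⟩
        f (map Fin.suc s ++ Fin.suc a ∷ Fin.suc b ∷ map Fin.suc t)
          ≈⟨ swap alt (map Fin.suc s) (Fin.suc a) (Fin.suc b) (map Fin.suc t) (length-map s (a ∷ b ∷ t) e) ⟩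
        - f (map Fin.suc s ++ Fin.suc b ∷ Fin.suc a ∷ map Fin.suc t)
          ≡⟨ ≡.cong (λ l → - f l) (Listₚ.map-++ Fin.suc s (b ∷ a ∷ t)) ⟨
        - f (map Fin.suc (s ++ b ∷ a ∷ t))                ∎
    ; repeat = λ s a t e → begin
        f (map Fin.suc (s ++ a ∷ a ∷ t))                  ≡⟨ ≡.cong f (Listₚ.map-++ Fin.suc s (a ∷ a ∷ t)) ⟩
        f (map Fin.suc s ++ Fin.suc a ∷ Fin.suc a ∷ map Fin.suc t)
          ≈⟨ repeat alt (map Fin.suc s) (Fin.suc a) (map Fin.suc t) (length-map s (a ∷ a ∷ t) e) ⟩
        0#                                                ∎
    }
    where
    length-map : ∀ (l l′ : List (Fin n)) → length (l ++ l′) ≡ m → length (map Fin.suc l ++ map Fin.suc l′) ≡ m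
    length-map l l′ e = ≡.trans (≡.cong length (≡.sym (Listₚ.map-++ Fin.suc l l′)))
                                (≡.trans (Listₚ.length-map Fin.suc (l ++ l′)) e)

  VanishesOnSorted : ∀ {n} → ℕ → (List (Fin n) → Carrier) → Set ℓ
  VanishesOnSorted {n} m f = ∀ (X : Subset n) → length (elems X) ≡ m → f (elems X) ≈ 0#

  -- Bubble x into its place in the increasing string elems Y.
  alternating-insert-vanishes : ∀ {n m} {f : List (Fin n) → Carrier} → Alternating m f → VanishesOnSorted m f →
                                ∀ x (Y : Subset n) → length (x ∷ elems Y) ≡ m → f (x ∷ elems Y) ≈ 0#
  alternating-insert-vanishes alt sorted Fin.zero (inside ∷ Y) e = repeat alt [] Fin.zero _ e
  alternating-insert-vanishes alt sorted Fin.zero (outside ∷ Y) e = sorted (inside ∷ Y) e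
  alternating-insert-vanishes {suc n} {m} {f} alt sorted (Fin.suc x) (outside ∷ Y) e =
    alternating-insert-vanishes (alternating-map-suc alt) sorted′ x Y
      (≡.trans (≡.cong suc (≡.sym (Listₚ.length-map Fin.suc (elems Y)))) e)
    where
    sorted′ : VanishesOnSorted m (λ l → f (map Fin.suc l))
    sorted′ X eX = sorted (outside ∷ X) (≡.trans (Listₚ.length-map Fin.suc (elems X)) eX)
  alternating-insert-vanishes {suc n} {suc m} {f} alt sorted (Fin.suc x) (inside ∷ Y) e = begin
    f (Fin.suc x ∷ Fin.zero ∷ map Fin.suc (elems Y))   ≈⟨ swap alt [] (Fin.suc x) Fin.zero _ e ⟩
    - f (Fin.zero ∷ map Fin.suc (x ∷ elems Y))          ≈⟨ -‿cong (alternating-insert-vanishes alt′ sorted′ x Y e′) ⟩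
    - 0#                                               ≈⟨ -0#≈0# ⟩
    0#                                                 ∎
    where
    alt′ : Alternating m (λ l → f (Fin.zero ∷ map Fin.suc l))
    alt′ = alternating-map-suc (alternating-∷ Fin.zero alt)
    sorted′ : VanishesOnSorted m (λ l → f (Fin.zero ∷ map Fin.suc l))
    sorted′ X eX = sorted (inside ∷ X) (≡.cong suc (≡.trans (Listₚ.length-map Fin.suc (elems X)) eX))
    e′ : length (x ∷ elems Y) ≡ m
    e′ = ≡.trans (≡.cong suc (≡.sym (Listₚ.length-map Fin.suc (elems Y)))) (ℕₚ.suc-injective e)

  alternating-vanishes : ∀ {n m} {f : List (Fin n) → Carrier} → Alternating m f → VanishesOnSorted m f →
                         ∀ s → length s ≡ m → f s ≈ 0#
  alternating-vanishes {n} {f = f} alt sorted [] ≡.refl =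
    trans (reflexive (≡.cong f (≡.sym (elems-⊥ {n})))) (sorted Sub.⊥ (≡.cong length (elems-⊥ {n})))
  alternating-vanishes {m = suc m} alt sorted (x ∷ s) e =
    alternating-vanishes (alternating-∷ x alt)
      (λ Y eY → alternating-insert-vanishes alt sorted x Y (≡.cong suc eY)) s (ℕₚ.suc-injective e)

  ε-swap : ∀ {n} (s : List (Fin n)) a b t → a ≢ b → ε (s ++ b ∷ a ∷ t) ≈ - ε (s ++ a ∷ b ∷ t)
  ε-swap s a b t a≢b with ℕₚ.<-cmp (toℕ a) (toℕ b)
  ... | tri< a<b _ _ = reflexive (≡.cong sgn (inversions-swap s a b t a<b))
  ... | tri≈ _ a≡b _ = contradiction (Finₚ.toℕ-injective a≡b) a≢b
  ... | tri> _ _ b<a = begin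
    ε (s ++ b ∷ a ∷ t)     ≈⟨ -‿involutive _ ⟨
    - - ε (s ++ b ∷ a ∷ t) ≡⟨ ≡.cong (λ i → - sgn i) (inversions-swap s b a t b<a) ⟨
    - ε (s ++ a ∷ b ∷ t)   ∎

  ε-elems : ∀ {n} (X : Subset n) → ε (elems X) ≈ 1#
  ε-elems X = reflexive (≡.cong sgn (inversions-elems X))

  module _ {n} (p : Subset n → Carrier) where

    coord : List (Fin n) → Carrier
    coord s with ∣ setOf s ∣ ℕ.≟ length s
    ... | yes _ = p (setOf s)
    ... | no _ = 0#

    signedCoord : List (Fin n) → Carrier
    signedCoord s = ε s * coord s

    coord-distinct : ∀ s → ∣ setOf s ∣ ≡ length s → coord s ≡ p (setOf s)
    coord-distinct s distinct with ∣ setOf s ∣ ℕ.≟ length s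
    ... | yes _ = ≡.refl
    ... | no repeated = contradiction distinct repeated

    coord-repeated : ∀ s → ∣ setOf s ∣ ≢ length s → coord s ≡ 0#
    coord-repeated s repeated with ∣ setOf s ∣ ℕ.≟ length s
    ... | yes distinct = contradiction distinct repeated
    ... | no _ = ≡.refl

    coord-cong : ∀ l l′ → setOf l ≡ setOf l′ → length l ≡ length l′ → coord l ≡ coord l′
    coord-cong l l′ l≡l′ |l|≡|l′| with ∣ setOf l ∣ ℕ.≟ length l
    ... | yes distinct = ≡.trans (≡.cong p l≡l′) (≡.sym (coord-distinct l′
            (≡.trans (≡.cong ∣_∣ (≡.sym l≡l′)) (≡.trans distinct |l|≡|l′|))))
    ... | no repeated = ≡.sym (coord-repeated l′
            (λ distinct → repeated (≡.trans (≡.cong ∣_∣ l≡l′) (≡.trans distinct (≡.sym |l|≡|l′|)))))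

    signedCoord-repeat : ∀ s a t → signedCoord (s ++ a ∷ a ∷ t) ≈ 0#
    signedCoord-repeat s a t = trans (*-congˡ (reflexive (coord-repeated (s ++ a ∷ a ∷ t)
      (ℕₚ.<⇒≢ (∣setOf∣<length-repeat s a t))))) (zeroʳ _)

    signedCoord-alternating : ∀ m → Alternating m signedCoord
    signedCoord-alternating m = record { swap = λ s a b t _ → swap′ s a b t ; repeat = λ s a t _ → signedCoord-repeat s a t }
      where
      swap′ : ∀ s a b t → signedCoord (s ++ a ∷ b ∷ t) ≈ - signedCoord (s ++ b ∷ a ∷ t)
      swap′ s a b t with a Finₚ.≟ b
      ... | yes ≡.refl = trans (signedCoord-repeat s a t) (trans (sym -0#≈0#) (-‿cong (sym (signedCoord-repeat s a t))))
      ... | no a≢b = begin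
        ε (s ++ a ∷ b ∷ t) * coord (s ++ a ∷ b ∷ t)
          ≈⟨ *-cong (ε-swap s b a t (a≢b ∘ ≡.sym))
                    (reflexive (coord-cong (s ++ a ∷ b ∷ t) (s ++ b ∷ a ∷ t) (setOf-swap s a b t) (≡.sym (length-swap s a b t)))) ⟩
        - ε (s ++ b ∷ a ∷ t) * coord (s ++ b ∷ a ∷ t)
          ≈⟨ -‿distribˡ-* _ _ ⟨
        - signedCoord (s ++ b ∷ a ∷ t)
          ∎

    signedCoord-elems : ∀ X → signedCoord (elems X) ≈ p X
    signedCoord-elems X = begin
      ε (elems X) * coord (elems X)  ≈⟨ *-cong (ε-elems X) (reflexive (coord-distinct (elems X) distinct)) ⟩
      1# * p (setOf (elems X))       ≈⟨ *-identityˡ _ ⟩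
      p (setOf (elems X))            ≡⟨ ≡.cong p (setOf-elems X) ⟩
      p X                            ∎
      where
      distinct : ∣ setOf (elems X) ∣ ≡ length (elems X)
      distinct = ≡.trans (≡.cong ∣_∣ (setOf-elems X)) (≡.sym (length-elems X))

    pAdd≡coord : ∀ I j → pAdd p I j ≡ coord (elems I ++ j ∷ [])
    pAdd≡coord I j with j Subₚ.∈? I
    ... | yes j∈I = ≡.sym (coord-repeated (elems I ++ j ∷ []) (∈⇒∣setOf[elems∷ʳ]∣≢length j∈I))
    ... | no j∉I = ≡.sym (≡.trans (coord-distinct (elems I ++ j ∷ []) (∉⇒∣setOf[elems∷ʳ]∣≡length j∉I))
                                  (≡.cong p (setOf-elems-∷ʳ I j)))

    pAdd-∈ : ∀ {I x} → x ∈ˢ I → pAdd p I x ≡ 0#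
    pAdd-∈ {I} {x} x∈I with x Subₚ.∈? I
    ... | yes _ = ≡.refl
    ... | no x∉I = contradiction x∈I x∉I

    pAdd-∉ : ∀ {I x} → ¬ x ∈ˢ I → pAdd p I x ≡ p (I ∪ ⁅ x ⁆)
    pAdd-∉ {I} {x} x∉I with x Subₚ.∈? I
    ... | yes x∈I = contradiction x∈I x∉I
    ... | no _ = ≡.refl

    sp≈signedCoord : ∀ I j → sp p I j ≈ signedCoord (elems I ++ j ∷ [])
    sp≈signedCoord I j = *-congˡ (reflexive (pAdd≡coord I j))

  -- As for `counter`, this names the accumulator local to Defs.pluckerPoly.
  mutual
    pluckerSum : ∀ {n} → (Subset n → Carrier) → Subset n → Subset n → ℕ → List (Fin n) → Carrier
    pluckerSum = _

    pluckerPoly≡pluckerSum : ∀ {n} (p : Subset n → Carrier) I J → pluckerPoly p I J ≡ pluckerSum p I J 0 (elems J)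
    pluckerPoly≡pluckerSum p I J with 0 | elems J
    ... | i | js = ≡.refl

  pluckerSum≈signedSum : ∀ {n} (p : Subset n → Carrier) I J i js →
    pluckerSum p I J i js ≈ signedSum (sp p I) (signedCoord p) i (map (λ j → j , elems (J ∖ j)) js)
  pluckerSum≈signedSum p I J i [] = refl
  pluckerSum≈signedSum p I J i (j ∷ js) =
    +-cong (*-congˡ (*-congˡ (sym (signedCoord-elems p (J ∖ j))))) (pluckerSum≈signedSum p I J (suc i) js)

  pluckerPoly≈expand : ∀ {n} (p : Subset n → Carrier) I J → pluckerPoly p I J ≈ expand (sp p I) (signedCoord p) (elems J)
  pluckerPoly≈expand p I J = begin
    pluckerPoly p I J
      ≡⟨ pluckerPoly≡pluckerSum p I J ⟩
    pluckerSum p I J 0 (elems J)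
      ≈⟨ pluckerSum≈signedSum p I J 0 (elems J) ⟩
    signedSum (sp p I) (signedCoord p) 0 (map (λ j → j , elems (J ∖ j)) (elems J))
      ≡⟨ ≡.cong (signedSum (sp p I) (signedCoord p) 0) (picks-elems J) ⟨
    signedSum (sp p I) (signedCoord p) 0 (picks (elems J))
      ≈⟨ signedSum-picks (sp p I) (signedCoord p) 0 (elems J) ⟩
    1# * expand (sp p I) (signedCoord p) (elems J)
      ≈⟨ *-identityˡ _ ⟩
    expand (sp p I) (signedCoord p) (elems J)
      ∎

  pluckerRelations-allStrings : ∀ {n k} {p : Subset n → Carrier} → PluckerRelations (suc k) n p →
                                ∀ I → ∣ I ∣ ≡ k → ∀ s → length s ≡ suc (suc k) →
                                expand (sp p I) (signedCoord p) s ≈ 0#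
  pluckerRelations-allStrings {k = k} {p} plücker I ∣I∣≡k =
    alternating-vanishes (expand-alternating (sp p I) (signedCoord-alternating p (suc k)))
      λ J e → trans (sym (pluckerPoly≈expand p I J)) (plücker I J ∣I∣≡k (≡.trans (≡.sym (length-elems J)) e))

  module _ {n k} {p : Subset n → Carrier} (A : Fin (suc k) → Fin n → Carrier) (λ₀ : Carrier)
           (p≈λ₀minor : ∀ I → ∣ I ∣ ≡ suc k → p I ≈ λ₀ * minor A I) where

    signedCoord≈λ₀det : ∀ s → length s ≡ suc k → signedCoord p s ≈ λ₀ * det (rows A) s
    signedCoord≈λ₀det = λ s e → x∙y⁻¹≈ε⇒x≈y _ _ (alternating-vanishes difference-alternating
      (λ X e′ → trans (-‿cong₂ (trans (signedCoord-elems p X) (p≈λ₀minor X (≡.trans (≡.sym (length-elems X)) e′))) refl)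
                      (-‿inverseʳ _)) s e)
      where
      det-alternating′ : Alternating (suc k) (det (rows A))
      det-alternating′ = ≡.subst (λ m → Alternating m (det (rows A)))
        (≡.trans (Listₚ.length-map A (allFin (suc k))) (Listₚ.length-tabulate id)) (det-alternating (rows A))
      difference-alternating : Alternating (suc k) (λ s → signedCoord p s - λ₀ * det (rows A) s)
      difference-alternating = alternating-linear λ₀ (signedCoord-alternating p (suc k)) det-alternating′

    sp≈λ₀det : ∀ I → ∣ I ∣ ≡ k → ∀ j → sp p I j ≈ λ₀ * det (rows A) (elems I ++ j ∷ [])
    sp≈λ₀det I ∣I∣≡k j = trans (sp≈signedCoord p I j)
      (signedCoord≈λ₀det (elems I ++ j ∷ []) (≡.trans (length-elems-∷ʳ I j) (≡.cong suc (≡.trans (length-elems I) ∣I∣≡k))))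

    sp-inRowSpan : ∀ I → ∣ I ∣ ≡ k → InRowSpan A (λ x → det (rows A) (elems I ++ x ∷ []))
    sp-inRowSpan I ∣I∣≡k = inRowSpan-det A (elems I) (≡.cong suc (≡.trans (length-elems I) ∣I∣≡k))

    decomposable⇒pluckerRelations : PluckerRelations (suc k) n p
    decomposable⇒pluckerRelations I J ∣I∣≡k ∣J∣≡2+k with sp-inRowSpan I ∣I∣≡k
    ... | γ , inSpan = begin
      pluckerPoly p I J
        ≈⟨ pluckerPoly≈expand p I J ⟩
      expand (sp p I) (signedCoord p) (elems J)
        ≈⟨ expand-congʳ _ (elems J) (λ x → trans (sp≈λ₀det I ∣I∣≡k x) (*-congˡ (inSpan x))) ⟩
      expand (λ x → λ₀ * lincomb A γ x) (signedCoord p) (elems J)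
        ≈⟨ expand-row-scale (lincomb A γ) λ₀ _ (elems J) ⟩
      λ₀ * expand (lincomb A γ) (signedCoord p) (elems J)
        ≈⟨ *-congˡ (expand-cong _ (elems J) λ l e → signedCoord≈λ₀det l (ℕₚ.suc-injective (≡.trans e (≡.trans (length-elems J) ∣J∣≡2+k)))) ⟩
      λ₀ * expand (lincomb A γ) (λ l → λ₀ * det (rows A) l) (elems J)
        ≈⟨ *-congˡ (expand-scale (lincomb A γ) λ₀ (det (rows A)) (elems J)) ⟩
      λ₀ * (λ₀ * expand (lincomb A γ) (det (rows A)) (elems J))
        ≈⟨ *-congˡ (*-congˡ (expand-row-lincomb A γ (det (rows A)) (elems J))) ⟩
      λ₀ * (λ₀ * sum (λ t → γ t * expand (A t) (det (rows A)) (elems J)))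
        ≈⟨ *-congˡ (*-congˡ (sum-vanishes _ repeated-row)) ⟩
      λ₀ * (λ₀ * 0#)
        ≈⟨ trans (*-congˡ (zeroʳ λ₀)) (zeroʳ λ₀) ⟩
      0#
        ∎
      where
      repeated-row : ∀ t → γ t * expand (A t) (det (rows A)) (elems J) ≈ 0#
      repeated-row t = trans (*-congˡ (expand-det-row (A t) (rows A) (elems J)
        (Any.∈-map⁺ A (Any.∈-tabulate⁺ {f = id} t)))) (zeroʳ (γ t))

    decomposable⇒orthoQuadrics : (∀ γ δ → form (lincomb A γ) (lincomb A δ) ≈ 0#) → OrthoQuadrics (suc k) n p
    decomposable⇒orthoQuadrics isotropic I J ∣I∣≡k ∣J∣≡k with sp-inRowSpan I ∣I∣≡k | sp-inRowSpan J ∣J∣≡k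
    ... | γ , γ-span | δ , δ-span = begin
      orthoQuadric p I J
        ≡⟨ Σ≡sum (λ ℓ → sp p I ℓ * sp p J ℓ) ⟩
      sum (λ ℓ → sp p I ℓ * sp p J ℓ)
        ≈⟨ sum-cong-≋ (λ ℓ → trans (*-cong (onSpan I ∣I∣≡k γ γ-span ℓ) (onSpan J ∣J∣≡k δ δ-span ℓ)) (interchange* _ _ _ _)) ⟩
      sum (λ ℓ → (λ₀ * λ₀) * (lincomb A γ ℓ * lincomb A δ ℓ))
        ≈⟨ *-distribˡ-sum (λ₀ * λ₀) (λ ℓ → lincomb A γ ℓ * lincomb A δ ℓ) ⟨
      (λ₀ * λ₀) * sum (λ ℓ → lincomb A γ ℓ * lincomb A δ ℓ)
        ≈⟨ *-congˡ (trans (reflexive (≡.sym (form≡sum (lincomb A γ) (lincomb A δ)))) (isotropic γ δ)) ⟩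
      (λ₀ * λ₀) * 0#
        ≈⟨ zeroʳ _ ⟩
      0#
        ∎
      where
      onSpan : ∀ I → ∣ I ∣ ≡ k → ∀ γ → (∀ x → det (rows A) (elems I ++ x ∷ []) ≈ lincomb A γ x) →
               ∀ ℓ → sp p I ℓ ≈ λ₀ * lincomb A γ ℓ
      onSpan I ∣I∣≡k γ inSpan ℓ = trans (sp≈λ₀det I ∣I∣≡k ℓ) (*-congˡ (inSpan ℓ))

  module _ {n k} {p : Subset n → Carrier} (plücker : PluckerRelations (suc k) n p)
           {I₀ : Subset n} (∣I₀∣≡1+k : ∣ I₀ ∣ ≡ suc k) (pI₀≉0 : ¬ p I₀ ≈ 0#) where

    row : Fin n → Fin n → Carrier
    row y = sp p (I₀ ∖ y)

    ∣I₀-y∣≡k : ∀ {y} → y ∈ˢ I₀ → ∣ I₀ ∖ y ∣ ≡ k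
    ∣I₀-y∣≡k y∈I₀ = ℕₚ.suc-injective (≡.trans (x∈p⇒1+∣p-x∣≡∣p∣ y∈I₀) ∣I₀∣≡1+k)

    row-offDiagonal : ∀ {x y} → x ∈ˢ I₀ → x ≢ y → row y x ≈ 0#
    row-offDiagonal x∈I₀ x≢y = trans (*-congˡ (reflexive (pAdd-∈ p (Subₚ.x∈p∧x≢y⇒x∈p-y x∈I₀ x≢y)))) (zeroʳ _)

    row-diagonal≉0 : ∀ {y} → y ∈ˢ I₀ → ¬ row y y ≈ 0#
    row-diagonal≉0 {y} y∈I₀ = x*y≉0 (sgn≉0 (inversions (elems (I₀ ∖ y) ++ y ∷ [])))
      (λ pAdd≈0 → pI₀≉0 (trans (reflexive (≡.sym pAdd≡pI₀)) pAdd≈0))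
      where
      pAdd≡pI₀ : pAdd p (I₀ ∖ y) y ≡ p I₀
      pAdd≡pI₀ = ≡.trans (pAdd-∉ p (x∉p-x y I₀)) (≡.cong p (x∈p⇒[p-x]∪⁅x⁆≡p y∈I₀))

    a : List (Fin n)
    a = elems I₀

    ∈a⇒∈I₀ : ∀ {u y v} → u ++ y ∷ v ≡ a → y ∈ˢ I₀
    ∈a⇒∈I₀ {u} {y} e = ∈elems⇒∈ I₀ (≡.subst (y ∈_) e (Any.∈-++⁺ʳ u (here ≡.refl)))

    diagonal : List (Fin n) → Carrier
    diagonal [] = 1#
    diagonal (y ∷ v) = diagonal v * row y y

    -- The Plücker relation for I₀ ∖ y at the string u y s, where row y vanishes on u.
    expand-row-pivot : ∀ u y v s → u ++ y ∷ v ≡ a → length s ≡ suc (length v) →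
                       expand (row y) (λ r → signedCoord p (u ++ y ∷ r)) s ≈ row y y * signedCoord p (u ++ s)
    expand-row-pivot u y v s e |s|≡1+|v| = sym (x∙y⁻¹≈ε⇒x≈y _ _ (sgn*x≈0⇒x≈0 (length u) (begin
      sgn (length u) * expand (row y) (λ l → signedCoord p (u ++ l)) (y ∷ s)
        ≈⟨ expand-++ (row y) (signedCoord p) u (y ∷ s) row-vanishes-on-u ⟨
      expand (row y) (signedCoord p) (u ++ y ∷ s)
        ≈⟨ pluckerRelations-allStrings plücker (I₀ ∖ y) (∣I₀-y∣≡k (∈a⇒∈I₀ e)) (u ++ y ∷ s) |u++y∷s|≡2+k ⟩
      0#
        ∎)))
      where
      row-vanishes-on-u : ∀ x → x ∈ u → row y x ≈ 0#
      row-vanishes-on-u x x∈u = row-offDiagonal (∈elems⇒∈ I₀ (≡.subst (x ∈_) e (Any.∈-++⁺ˡ x∈u)))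
        (Unique-++-∷⇒≢ u (≡.subst Unique (≡.sym e) (elems-unique I₀)) x∈u)
      |u++y∷s|≡2+k : length (u ++ y ∷ s) ≡ suc (suc k)
      |u++y∷s|≡2+k = ≡.trans (length-++-∷-suc u y |s|≡1+|v|)
        (≡.cong suc (≡.trans (≡.cong length e) (≡.trans (length-elems I₀) ∣I₀∣≡1+k)))

    det-rows-suffix : ∀ v u → u ++ v ≡ a → ∀ s → length s ≡ length v →
                      det (map row v) s * p I₀ ≈ diagonal v * signedCoord p (u ++ s)
    det-rows-suffix [] u e [] _ = *-congˡ (sym (trans (reflexive (≡.cong (signedCoord p) e)) (signedCoord-elems p I₀)))
    det-rows-suffix (y ∷ v) u e s |s|≡1+|v| = begin
      det (row y ∷ map row v) s * p I₀
        ≈⟨ trans (*-congʳ (det-∷ (row y) (map row v) s)) (*-comm _ _) ⟩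
      p I₀ * expand (row y) (det (map row v)) s
        ≈⟨ expand-scale (row y) (p I₀) (det (map row v)) s ⟨
      expand (row y) (λ r → p I₀ * det (map row v) r) s
        ≈⟨ expand-cong (row y) s (λ r e′ → trans (*-comm _ _) (trans
             (det-rows-suffix v (u ++ y ∷ []) (≡.trans (Listₚ.++-assoc u (y ∷ []) v) e) r (ℕₚ.suc-injective (≡.trans e′ |s|≡1+|v|)))
             (*-congˡ (reflexive (≡.cong (signedCoord p) (Listₚ.++-assoc u (y ∷ []) r)))))) ⟩
      expand (row y) (λ r → diagonal v * signedCoord p (u ++ y ∷ r)) s
        ≈⟨ expand-scale (row y) (diagonal v) _ s ⟩
      diagonal v * expand (row y) (λ r → signedCoord p (u ++ y ∷ r)) s
        ≈⟨ *-congˡ (expand-row-pivot u y v s e |s|≡1+|v|) ⟩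
      diagonal v * (row y y * signedCoord p (u ++ s))
        ≈⟨ *-assoc _ _ _ ⟨
      diagonal v * row y y * signedCoord p (u ++ s)
        ∎

    diagonal≉0 : ∀ v u → u ++ v ≡ a → ¬ diagonal v ≈ 0#
    diagonal≉0 [] u e 1≈0 = 0≉1 (sym 1≈0)
    diagonal≉0 (y ∷ v) u e = x*y≉0 (diagonal≉0 v (u ++ y ∷ []) (≡.trans (Listₚ.++-assoc u (y ∷ []) v) e)) (row-diagonal≉0 (∈a⇒∈I₀ e))

    minor-rows≈diagonal*p : ∀ I → ∣ I ∣ ≡ suc k → det (map row a) (elems I) * p I₀ ≈ diagonal a * p I
    minor-rows≈diagonal*p I ∣I∣≡1+k = trans (det-rows-suffix a [] ≡.refl (elems I) |I|≡|a|) (*-congˡ (signedCoord-elems p I))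
      where
      |I|≡|a| : length (elems I) ≡ length a
      |I|≡|a| = ≡.trans (length-elems I) (≡.trans ∣I∣≡1+k (≡.sym (≡.trans (length-elems I₀) ∣I₀∣≡1+k)))

    solution⇒inOGr : OrthoQuadrics (suc k) n p → InOGr (suc k) n p
    solution⇒inOGr quadrics with tabulation a (≡.trans (length-elems I₀) ∣I₀∣≡1+k) | inverse (diagonal a) (diagonal≉0 a [] ≡.refl)
    ... | g , g-tabulates-a | d⁻¹ , dd⁻¹≈1 = A , d⁻¹ * p I₀ , x*y≉0 d⁻¹≉0 pI₀≉0 , p≈λ₀minor , isotropic
      where
      A : Fin (suc k) → Fin n → Carrier
      A = row ∘ g
      d⁻¹≉0 : ¬ d⁻¹ ≈ 0#
      d⁻¹≉0 d⁻¹≈0 = 0≉1 (trans (sym (zeroʳ (diagonal a))) (trans (*-congˡ (sym d⁻¹≈0)) dd⁻¹≈1))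
      rows-A : rows A ≡ map row a
      rows-A = ≡.trans (Listₚ.map-∘ (allFin (suc k))) (≡.cong (map row) g-tabulates-a)
      p≈λ₀minor : ∀ I → ∣ I ∣ ≡ suc k → p I ≈ (d⁻¹ * p I₀) * minor A I
      p≈λ₀minor I ∣I∣≡1+k = begin
        p I                                       ≈⟨ *-identityˡ _ ⟨
        1# * p I                                  ≈⟨ *-congʳ (trans (*-comm d⁻¹ (diagonal a)) dd⁻¹≈1) ⟨
        (d⁻¹ * diagonal a) * p I                  ≈⟨ *-assoc _ _ _ ⟩
        d⁻¹ * (diagonal a * p I)                  ≈⟨ *-congˡ (minor-rows≈diagonal*p I ∣I∣≡1+k) ⟨
        d⁻¹ * (det (map row a) (elems I) * p I₀)  ≈⟨ trans (*-congˡ (*-comm _ _)) (sym (*-assoc _ _ _)) ⟩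
        (d⁻¹ * p I₀) * det (map row a) (elems I)  ≡⟨ ≡.cong (λ rs → (d⁻¹ * p I₀) * det rs (elems I)) rows-A ⟨
        (d⁻¹ * p I₀) * minor A I                  ∎
      g∈I₀ : ∀ t → g t ∈ˢ I₀
      g∈I₀ t = ∈elems⇒∈ I₀ (≡.subst (g t ∈_) g-tabulates-a (Any.∈-map⁺ g (Any.∈-tabulate⁺ {f = id} t)))
      isotropic : ∀ γ δ → form (lincomb A γ) (lincomb A δ) ≈ 0#
      isotropic = form-vanishes-on-span A λ r s → quadrics (I₀ ∖ g r) (I₀ ∖ g s) (∣I₀-y∣≡k (g∈I₀ r)) (∣I₀-y∣≡k (g∈I₀ s))

theorem2p1 : ∀ {c ℓ} (F : Field c ℓ) → FieldNotions.AlgClosed F → FieldNotions.CharZero F →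
    (k n : ℕ) → 1 ≤ k → k ≤ n →
    (p : Subset n → Field.Carrier F) → FieldNotions.Nonzero F k n p →
    (FieldNotions.InOGr F k n p ⇔ (FieldNotions.PluckerRelations F k n p × FieldNotions.OrthoQuadrics F k n p))
theorem2p1 F _ _ (suc k) n (s≤s z≤n) _ p (I₀ , ∣I₀∣≡1+k , pI₀≉0) = mk⇔
  (λ (A , λ₀ , _ , p≈λ₀minor , isotropic) →
     decomposable⇒pluckerRelations F A λ₀ p≈λ₀minor , decomposable⇒orthoQuadrics F A λ₀ p≈λ₀minor isotropic)
  (λ (plücker , quadrics) → solution⇒inOGr F plücker ∣I₀∣≡1+k pI₀≉0 quadrics)
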